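{- Let $k,l,d\ge 0$ be integers with $k\ge l$ and $k+l\le d$, and let $X(\le d)$ be a pure simplicial complex with probability measures $\Pi_1,\dots,\Pi_d$ as in the context. Then for every integer $0\le u\le l$, as Markov kernels from $X(k)$ to $X(l)$, \[ \binom{k}{l-u}\,\mathbf S_{k,l,u}=\sum_{j=0}^{u}(-1)^{u-j}\binom{k+j}{l}\binom{u}{j}\,\mathbf N^{(j)}_{k,l}. \]
   Context: Simplicial complex: downward-closed family of subsets of $[n]$, $X(i)$ faces of size $i$, pure means every face lies in a face of size $d$. Given $\Pi_d$ on $X(d)$, $\Pi_i$ is the law of a uniformly random $i$-subset of a $\Pi_d$-random top face. Up-walk: from $\mathfrak b\in X(i)$ move to $\mathfrak b\sqcup\{x\}$ with probability $\Pi_{i+1}(\mathfrak b\sqcup\{x\})/((i+1)\Pi_i(\mathfrak b))$; $p^{(u)}_{\mathfrak s}$ is the law after $u$ up-steps from $\mathfrak s$. Canonical walk $\mathbf N^{(j)}_{k,l}$: from $\mathfrak s\in X(k)$ pick $\mathfrak s''\sim p^{(j)}_{\mathfrak s}$ in $X(k+j)$, then move to a uniformly random $l$-subset of $\mathfrak s''$. Swap walk $\mathbf S_{k,l,u}$: from $\mathfrak s$ pick $\mathfrak s''\sim p^{(u)}_{\mathfrak s}$ in $X(k+u)$, then move to a uniformly random $l$-subset $\mathfrak s'$ of $\mathfrak s''$ with $|\mathfrak s'\cap(\mathfrak s''\setminus\mathfrak s)|=u$.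
   Formalization: The probability measure Π_d on X(d) takes only rational values, so the walks $\mathbf S_{k,l,u}$ and $\mathbf N^{(j)}_{k,l}$ have rational transition probabilities. -}

module Defs where

open import Data.Nat as ℕ using (ℕ; zero; suc)
open import Data.Bool using (Bool; true; false; if_then_else_; _∧_; T)
open import Data.List using (List; []; _∷_; map; _++_; foldr; filter; length)
open import Data.Vec using (Vec; []; _∷_)
open import Data.Vec.Properties using (≡-dec)
import Data.Bool.Properties as BoolP
open import Data.Fin.Subset using (Subset; _⊆_; ∣_∣; _∩_; _─_)
open import Data.Fin.Subset.Properties using (_⊆?_)
open import Data.Rational using (ℚ; 0ℚ; 1ℚ; _+_; _*_; _÷_; -_; _≟_; _/_)
open import Data.Rational.Base using (≢-nonZero)
open import Data.Integer using (+_)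
open import Relation.Nullary using (yes; no; does)
open import Relation.Binary.PropositionalEquality using (_≡_)

allSubsets : (n : ℕ) → List (Subset n)
allSubsets zero = [] ∷ []
allSubsets (suc n) = map (false ∷_) (allSubsets n) ++ map (true ∷_) (allSubsets n)

sumℚ : List ℚ → ℚ
sumℚ = foldr _+_ 0ℚ

Σsub : (n : ℕ) → (Subset n → ℚ) → ℚ
Σsub n f = sumℚ (map f (allSubsets n))

ℕ→ℚ : ℕ → ℚ
ℕ→ℚ m = (+ m) / 1

𝟙 : Bool → ℚ
𝟙 true = 1ℚ
𝟙 false = 0ℚ

-- division with the convention p / 0 = 0 (only used where the paper's
-- denominators are nonzero)
_÷₀_ : ℚ → ℚ → ℚ
p ÷₀ q with q ≟ 0ℚ
... | yes _ = 0ℚ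
... | no q≢0 = _÷_ p q {{≢-nonZero q≢0}}

sgn : ℕ → ℚ
sgn zero = 1ℚ
sgn (suc m) = - sgn m

_⊆ᵇ_ : ∀ {n} → Subset n → Subset n → Bool
s ⊆ᵇ t = does (s ⊆? t)

_==_ : ∀ {n} → Subset n → Subset n → Bool
s == t = does (≡-dec BoolP._≟_ s t)

_=ℕ_ : ℕ → ℕ → Bool
a =ℕ b = does (a ℕ.≟ b)

count : (n : ℕ) → (Subset n → Bool) → ℕ
count n P = length (filter (λ s → T? (P s)) (allSubsets n))
  where
  open import Relation.Nullary.Decidable using (T?)

uniform : (n : ℕ) → (Subset n → Bool) → Subset n → ℚ
uniform n P s = 𝟙 (P s) ÷₀ ℕ→ℚ (count n P)

-- Simplicial complexes on vertex set [n] = Fin n, given by a membership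
-- test X : Subset n → Bool.

DownwardClosed : (n : ℕ) → (Subset n → Bool) → Set
DownwardClosed n X = ∀ (s t : Subset n) → s ⊆ t → T (X t) → T (X s)

Pure : (n d : ℕ) → (Subset n → Bool) → Set
Pure n d X = ∀ (s : Subset n) → T (X s) →
  Data.Product.Σ (Subset n) (λ t → s ⊆ t Data.Product.× (∣ t ∣ ≡ d Data.Product.× T (X t)))
  where import Data.Product

inX : (n : ℕ) → (Subset n → Bool) → ℕ → Subset n → Bool
inX n X i s = X s ∧ (∣ s ∣ =ℕ i)

IsProbOnTop : (n d : ℕ) → (Subset n → Bool) → (Subset n → ℚ) → Set
IsProbOnTop n d X Πd =
  (∀ t → T (inX n X d t) → 0ℚ Data.Rational.≤ Πd t)
  Data.Product.× (Σsub n (λ t → 𝟙 (inX n X d t) * Πd t) ≡ 1ℚ)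
  where import Data.Product; import Data.Rational

module Walks (n d : ℕ) (X : Subset n → Bool) (Πd : Subset n → ℚ) where

  Π : ℕ → Subset n → ℚ
  Π i b = Σsub n (λ t → 𝟙 (inX n X d t) * (Πd t *
            uniform n (λ c → (c ⊆ᵇ t) ∧ (∣ c ∣ =ℕ i)) b))

  up : Subset n → Subset n → ℚ
  up b c = 𝟙 ((b ⊆ᵇ c) ∧ ((∣ c ∣ =ℕ suc ∣ b ∣) ∧ X c))
           * (Π (suc ∣ b ∣) c ÷₀ (ℕ→ℚ (suc ∣ b ∣) * Π ∣ b ∣ b))

  p : ℕ → Subset n → Subset n → ℚ
  p zero s t = 𝟙 (s == t)
  p (suc u) s t = Σsub n (λ t' → p u s t' * up t' t)

  N : ℕ → ℕ → ℕ → Subset n → Subset n → ℚ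
  N j k l s s' = Σsub n (λ s'' → p j s s'' *
                   uniform n (λ c → (c ⊆ᵇ s'') ∧ (∣ c ∣ =ℕ l)) s')

  S : ℕ → ℕ → ℕ → Subset n → Subset n → ℚ
  S k l u s s' = Σsub n (λ s'' → p u s s'' *
                   uniform n (λ c → (c ⊆ᵇ s'') ∧ ((∣ c ∣ =ℕ l) ∧
                                     (∣ c ∩ (s'' ─ s) ∣ =ℕ u))) s')

Σupto : ℕ → (ℕ → ℚ) → ℚ
Σupto zero f = f zero
Σupto (suc u) f = Σupto u f + f (suc u)

-- Let G(b) be the Πd-mass of the top faces containing b. Then Π_i(b) = G(b) / C(d,i) on X(i),
-- so G(t′) · up(t′,t) = G(t) · C(d,m) / ((m+1) C(d,m+1)) for t′ ⊂ t of sizes m, m+1, and by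
-- induction the up-walk from s ∈ X(k) has law p^(j)_s(t) = G(t) / (C(d−k,j) G(s)) on the
-- (k+j)-faces t ⊇ s. With U = s ∪ s′ this gives
--   C(k,l−u) S(s,s′)      = [|U| = k+u] G(U) / (C(d−k,u) G(s)),
--   C(k+j,l) N^(j)(s,s′) = Σ_T Πd(T) #{t : U ⊆ t ⊆ T, |t| = k+j} / (C(d−k,j) G(s)).
-- For |U| = k+δ the count is C(d−k−δ, j−δ) = C(d−k,j) C(j,δ) / C(d−k,δ), and the finite
-- difference Σ_j (−1)^(u−j) C(u,j) C(j,δ) = [u = δ] collapses the alternating sum to the
-- swap side.
module Submission where

open import Defs
open import Data.Nat using (ℕ)
open import Data.Bool using (Bool; T)
open import Data.Fin.Subset using (Subset)
open import Data.Rational using (ℚ; 0ℚ)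

module ℚ-Arithmetic where
  open import Data.Nat as ℕ using (ℕ; zero; suc)
  open import Data.Bool using (true; false; _∧_; T)
  open import Data.Unit using (tt)
  open import Data.Integer as ℤ using (+_)
  import Data.Integer.Properties as ℤₚ
  open import Data.Rational
  open import Data.Rational.Properties
  import Data.Rational.Unnormalised as ℚᵘ
  import Data.Rational.Unnormalised.Properties as ℚᵘₚ
  open import Relation.Binary.PropositionalEquality
  open import Relation.Nullary using (Dec; yes; no)
  open import Data.Empty using (⊥-elim)
  open import Data.Rational.Solver
  open +-*-Solver

  ℕ→ℚ-+ : ∀ a b → ℕ→ℚ (a ℕ.+ b) ≡ ℕ→ℚ a + ℕ→ℚ b
  ℕ→ℚ-+ a b = toℚᵘ-injective (begin-equality
    toℚᵘ (ℕ→ℚ (a ℕ.+ b))               ≃⟨ toℚᵘ-fromℚᵘ (ℚᵘ.mkℚᵘ (+ (a ℕ.+ b)) 0) ⟩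
    ℚᵘ.mkℚᵘ (+ (a ℕ.+ b)) 0             ≃⟨ ℚᵘ.*≡* cross ⟩
    ℚᵘ.mkℚᵘ (+ a) 0 ℚᵘ.+ ℚᵘ.mkℚᵘ (+ b) 0 ≃⟨ ℚᵘₚ.+-cong (toℚᵘ-fromℚᵘ (ℚᵘ.mkℚᵘ (+ a) 0)) (toℚᵘ-fromℚᵘ (ℚᵘ.mkℚᵘ (+ b) 0)) ⟨
    toℚᵘ (ℕ→ℚ a) ℚᵘ.+ toℚᵘ (ℕ→ℚ b)     ≃⟨ toℚᵘ-homo-+ (ℕ→ℚ a) (ℕ→ℚ b) ⟨
    toℚᵘ (ℕ→ℚ a + ℕ→ℚ b)               ∎)
    where
    open ℚᵘₚ.≤-Reasoning
    cross : (+ (a ℕ.+ b)) ℤ.* (+ 1) ≡ ((+ a) ℤ.* (+ 1) ℤ.+ (+ b) ℤ.* (+ 1)) ℤ.* (+ 1)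
    cross rewrite ℤₚ.*-identityʳ (+ (a ℕ.+ b)) | ℤₚ.*-identityʳ (+ a) | ℤₚ.*-identityʳ (+ b)
                | ℤₚ.*-identityʳ (+ a ℤ.+ + b) = ℤₚ.pos-+ a b

  ℕ→ℚ-* : ∀ a b → ℕ→ℚ (a ℕ.* b) ≡ ℕ→ℚ a * ℕ→ℚ b
  ℕ→ℚ-* a b = toℚᵘ-injective (begin-equality
    toℚᵘ (ℕ→ℚ (a ℕ.* b))               ≃⟨ toℚᵘ-fromℚᵘ (ℚᵘ.mkℚᵘ (+ (a ℕ.* b)) 0) ⟩
    ℚᵘ.mkℚᵘ (+ (a ℕ.* b)) 0             ≃⟨ ℚᵘ.*≡* cross ⟩
    ℚᵘ.mkℚᵘ (+ a) 0 ℚᵘ.* ℚᵘ.mkℚᵘ (+ b) 0 ≃⟨ ℚᵘₚ.*-cong (toℚᵘ-fromℚᵘ (ℚᵘ.mkℚᵘ (+ a) 0)) (toℚᵘ-fromℚᵘ (ℚᵘ.mkℚᵘ (+ b) 0)) ⟨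
    toℚᵘ (ℕ→ℚ a) ℚᵘ.* toℚᵘ (ℕ→ℚ b)     ≃⟨ toℚᵘ-homo-* (ℕ→ℚ a) (ℕ→ℚ b) ⟨
    toℚᵘ (ℕ→ℚ a * ℕ→ℚ b)               ∎)
    where
    open ℚᵘₚ.≤-Reasoning
    cross : (+ (a ℕ.* b)) ℤ.* (+ 1) ≡ ((+ a) ℤ.* (+ b)) ℤ.* (+ 1)
    cross rewrite ℤₚ.*-identityʳ (+ (a ℕ.* b)) | ℤₚ.*-identityʳ (+ a ℤ.* + b) = ℤₚ.pos-* a b

  ℕ→ℚ-≢0 : ∀ {a} → a ≢ 0 → ℕ→ℚ a ≢ 0ℚ
  ℕ→ℚ-≢0 {zero} a≢0 = ⊥-elim (a≢0 refl)
  ℕ→ℚ-≢0 {suc a} _ ℕ→ℚa≡0 =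
    <-irrefl (sym ℕ→ℚa≡0) (positive⁻¹ (ℕ→ℚ (suc a)) {{normalize-pos (suc a) 1}})

  infix 8 1/₀_
  1/₀_ : ℚ → ℚ
  1/₀ q = 1ℚ ÷₀ q

  ÷₀≡*1/₀ : ∀ p q → p ÷₀ q ≡ p * 1/₀ q
  ÷₀≡*1/₀ p q with q ≟ 0ℚ
  ... | yes _   = sym (*-zeroʳ p)
  ... | no q≢0 = cong (p *_) (sym (*-identityˡ (1/_ q {{≢-nonZero q≢0}})))

  *-1/₀-inverseʳ : ∀ q → q ≢ 0ℚ → q * 1/₀ q ≡ 1ℚ
  *-1/₀-inverseʳ q q≢0 with q ≟ 0ℚ
  ... | yes q≡0 = ⊥-elim (q≢0 q≡0)
  ... | no q≢0  = trans (cong (q *_) (*-identityˡ _)) (*-inverseʳ q {{≢-nonZero q≢0}})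

  *-1/₀-cancelˡ : ∀ q x → q ≢ 0ℚ → 1/₀ q * (q * x) ≡ x
  *-1/₀-cancelˡ q x q≢0 = begin
    1/₀ q * (q * x) ≡⟨ solve 3 (λ i q x → i :* (q :* x) := (q :* i) :* x) refl (1/₀ q) q x ⟩
    (q * 1/₀ q) * x ≡⟨ cong (_* x) (*-1/₀-inverseʳ q q≢0) ⟩
    1ℚ * x          ≡⟨ *-identityˡ x ⟩
    x               ∎
    where open ≡-Reasoning

  1/₀-unique : ∀ q x → q * x ≡ 1ℚ → x ≡ 1/₀ q
  1/₀-unique q x qx≡1 = begin
    x               ≡⟨ *-1/₀-cancelˡ q x q≢0 ⟨
    1/₀ q * (q * x) ≡⟨ cong (1/₀ q *_) qx≡1 ⟩
    1/₀ q * 1ℚ      ≡⟨ *-identityʳ (1/₀ q) ⟩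
    1/₀ q           ∎
    where
    open ≡-Reasoning
    q≢0 : q ≢ 0ℚ
    q≢0 q≡0 = 1≢0 (trans (sym qx≡1) (trans (cong (_* x) q≡0) (*-zeroˡ x)))

  *-≢0 : ∀ p q → p ≢ 0ℚ → q ≢ 0ℚ → p * q ≢ 0ℚ
  *-≢0 p q p≢0 q≢0 pq≡0 = q≢0 (begin
    q               ≡⟨ *-1/₀-cancelˡ p q p≢0 ⟨
    1/₀ p * (p * q) ≡⟨ cong (1/₀ p *_) pq≡0 ⟩
    1/₀ p * 0ℚ      ≡⟨ *-zeroʳ (1/₀ p) ⟩
    0ℚ              ∎)
    where open ≡-Reasoning

  1/₀-1 : 1/₀ 1ℚ ≡ 1ℚ
  1/₀-1 = sym (1/₀-unique 1ℚ 1ℚ (*-identityˡ 1ℚ))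

  1/₀-* : ∀ p q → 1/₀ (p * q) ≡ 1/₀ p * 1/₀ q
  1/₀-* p q = by-cases (p ≟ 0ℚ) (q ≟ 0ℚ)
    where
    open ≡-Reasoning
    by-cases : Dec (p ≡ 0ℚ) → Dec (q ≡ 0ℚ) → 1/₀ (p * q) ≡ 1/₀ p * 1/₀ q
    by-cases (yes p≡0) _ = begin
      1/₀ (p * q)     ≡⟨ cong (λ e → 1/₀ (e * q)) p≡0 ⟩
      1/₀ (0ℚ * q)    ≡⟨ cong 1/₀_ (*-zeroˡ q) ⟩
      0ℚ              ≡⟨ *-zeroˡ (1/₀ q) ⟨
      1/₀ 0ℚ * 1/₀ q  ≡⟨ cong (λ e → 1/₀ e * 1/₀ q) p≡0 ⟨
      1/₀ p * 1/₀ q   ∎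
    by-cases (no _) (yes q≡0) = begin
      1/₀ (p * q)     ≡⟨ cong (λ e → 1/₀ (p * e)) q≡0 ⟩
      1/₀ (p * 0ℚ)    ≡⟨ cong 1/₀_ (*-zeroʳ p) ⟩
      0ℚ              ≡⟨ *-zeroʳ (1/₀ p) ⟨
      1/₀ p * 1/₀ 0ℚ  ≡⟨ cong (λ e → 1/₀ p * 1/₀ e) q≡0 ⟨
      1/₀ p * 1/₀ q   ∎
    by-cases (no p≢0) (no q≢0) = sym (1/₀-unique (p * q) (1/₀ p * 1/₀ q) (begin
      (p * q) * (1/₀ p * 1/₀ q)
        ≡⟨ solve 4 (λ p q x y → (p :* q) :* (x :* y) := (p :* x) :* (q :* y)) refl p q (1/₀ p) (1/₀ q) ⟩
      (p * 1/₀ p) * (q * 1/₀ q) ≡⟨ cong₂ _*_ (*-1/₀-inverseʳ p p≢0) (*-1/₀-inverseʳ q q≢0) ⟩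
      1ℚ                        ∎))

  1/₀-involutive : ∀ q → 1/₀ (1/₀ q) ≡ q
  1/₀-involutive q = by-cases (q ≟ 0ℚ)
    where
    by-cases : Dec (q ≡ 0ℚ) → 1/₀ (1/₀ q) ≡ q
    by-cases (yes q≡0) = trans (cong (λ e → 1/₀ (1/₀ e)) q≡0) (sym q≡0)
    by-cases (no q≢0)  = sym (1/₀-unique (1/₀ q) q (trans (*-comm (1/₀ q) q) (*-1/₀-inverseʳ q q≢0)))

  *-1/₀-cross : ∀ x y z w → x ≢ 0ℚ → w ≢ 0ℚ → y * w ≡ x * z → y * 1/₀ x ≡ z * 1/₀ w
  *-1/₀-cross x y z w x≢0 w≢0 yw≡xz = begin
    y * 1/₀ x                   ≡⟨ *-1/₀-cancelˡ w (y * 1/₀ x) w≢0 ⟨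
    1/₀ w * (w * (y * 1/₀ x))   ≡⟨ cong (1/₀ w *_) (solve 3 (λ w y i → w :* (y :* i) := i :* (y :* w)) refl w y (1/₀ x)) ⟩
    1/₀ w * (1/₀ x * (y * w))   ≡⟨ cong (λ e → 1/₀ w * (1/₀ x * e)) yw≡xz ⟩
    1/₀ w * (1/₀ x * (x * z))   ≡⟨ cong (1/₀ w *_) (*-1/₀-cancelˡ x z x≢0) ⟩
    1/₀ w * z                   ≡⟨ *-comm (1/₀ w) z ⟩
    z * 1/₀ w                   ∎
    where open ≡-Reasoning

  𝟙-∧ : ∀ a b → 𝟙 (a ∧ b) ≡ 𝟙 a * 𝟙 b
  𝟙-∧ true  b = sym (*-identityˡ (𝟙 b))
  𝟙-∧ false b = sym (*-zeroˡ (𝟙 b))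

  𝟙-idem : ∀ b → 𝟙 b * 𝟙 b ≡ 𝟙 b
  𝟙-idem true  = refl
  𝟙-idem false = refl

  𝟙-nonneg : ∀ b → 0ℚ ≤ 𝟙 b
  𝟙-nonneg true  = nonNegative⁻¹ 1ℚ
  𝟙-nonneg false = ≤-refl

  *-nonneg : ∀ p q → 0ℚ ≤ p → 0ℚ ≤ q → 0ℚ ≤ p * q
  *-nonneg p q 0≤p 0≤q =
    nonNegative⁻¹ (p * q) {{nonNeg*nonNeg⇒nonNeg p {{nonNegative 0≤p}} q {{nonNegative 0≤q}}}}

  𝟙-*-cong : ∀ b {x y} → (T b → x ≡ y) → 𝟙 b * x ≡ 𝟙 b * y
  𝟙-*-cong true          x≡y = cong (1ℚ *_) (x≡y tt)
  𝟙-*-cong false {x} {y} _   = trans (*-zeroˡ x) (sym (*-zeroˡ y))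

  𝟙²-*-cong : ∀ a b {x y} → (T a → T b → x ≡ y) → 𝟙 a * 𝟙 b * x ≡ 𝟙 a * 𝟙 b * y
  𝟙²-*-cong true  true          x≡y = cong (1ℚ * 1ℚ *_) (x≡y tt tt)
  𝟙²-*-cong true  false {x} {y} _   = trans (*-zeroˡ x) (sym (*-zeroˡ y))
  𝟙²-*-cong false true  {x} {y} _   = trans (*-zeroˡ x) (sym (*-zeroˡ y))
  𝟙²-*-cong false false {x} {y} _   = trans (*-zeroˡ x) (sym (*-zeroˡ y))

module Sums where
  open import Data.Nat as ℕ using (ℕ; zero; suc; z≤n)
  import Data.Nat.Properties as ℕₚ
  open import Data.Bool using (Bool; true; false)
  open import Data.List using ([]; _∷_; map; _++_; filter; length)
  open import Data.Vec using ([]; _∷_)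
  open import Data.Fin.Subset using (Subset)
  open import Data.Rational
  open import Data.Rational.Properties
  open import Relation.Binary.PropositionalEquality
  open import Relation.Nullary.Decidable using (T?)
  open import Data.Rational.Solver
  open +-*-Solver
  open ℚ-Arithmetic using (ℕ→ℚ-+)

  sumℚ-map-++ : ∀ {A : Set} (f : A → ℚ) xs ys →
    sumℚ (map f (xs ++ ys)) ≡ sumℚ (map f xs) + sumℚ (map f ys)
  sumℚ-map-++ f []       ys = sym (+-identityˡ _)
  sumℚ-map-++ f (x ∷ xs) ys = trans (cong (f x +_) (sumℚ-map-++ f xs ys)) (sym (+-assoc (f x) _ _))

  sumℚ-map-∘ : ∀ {A B : Set} (f : B → ℚ) (g : A → B) xs →
    sumℚ (map f (map g xs)) ≡ sumℚ (map (λ x → f (g x)) xs)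
  sumℚ-map-∘ f g []       = refl
  sumℚ-map-∘ f g (x ∷ xs) = cong (f (g x) +_) (sumℚ-map-∘ f g xs)

  Σsub-zero : ∀ f → Σsub 0 f ≡ f []
  Σsub-zero f = +-identityʳ (f [])

  Σsub-suc : ∀ n f → Σsub (suc n) f ≡ Σsub n (λ c → f (false ∷ c)) + Σsub n (λ c → f (true ∷ c))
  Σsub-suc n f = trans (sumℚ-map-++ f (map (false ∷_) (allSubsets n)) (map (true ∷_) (allSubsets n)))
    (cong₂ _+_ (sumℚ-map-∘ f (false ∷_) (allSubsets n)) (sumℚ-map-∘ f (true ∷_) (allSubsets n)))

  Σsub-cong : ∀ n {f g : Subset n → ℚ} → (∀ c → f c ≡ g c) → Σsub n f ≡ Σsub n g
  Σsub-cong zero    {f} {g} f≗g = trans (Σsub-zero f) (trans (f≗g []) (sym (Σsub-zero g)))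
  Σsub-cong (suc n) {f} {g} f≗g = trans (Σsub-suc n f) (trans
    (cong₂ _+_ (Σsub-cong n (λ c → f≗g (false ∷ c))) (Σsub-cong n (λ c → f≗g (true ∷ c))))
    (sym (Σsub-suc n g)))

  Σsub-+ : ∀ n (f g : Subset n → ℚ) → Σsub n (λ c → f c + g c) ≡ Σsub n f + Σsub n g
  Σsub-+ zero f g = trans (Σsub-zero (λ c → f c + g c)) (sym (cong₂ _+_ (Σsub-zero f) (Σsub-zero g)))
  Σsub-+ (suc n) f g = begin
    Σsub (suc n) (λ c → f c + g c)  ≡⟨ Σsub-suc n (λ c → f c + g c) ⟩
    Σsub n (λ c → f₀ c + g₀ c) + Σsub n (λ c → f₁ c + g₁ c)
      ≡⟨ cong₂ _+_ (Σsub-+ n f₀ g₀) (Σsub-+ n f₁ g₁) ⟩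
    (Σsub n f₀ + Σsub n g₀) + (Σsub n f₁ + Σsub n g₁)
      ≡⟨ solve 4 (λ a b c d → (a :+ b) :+ (c :+ d) := (a :+ c) :+ (b :+ d)) refl
           (Σsub n f₀) (Σsub n g₀) (Σsub n f₁) (Σsub n g₁) ⟩
    (Σsub n f₀ + Σsub n f₁) + (Σsub n g₀ + Σsub n g₁)
      ≡⟨ cong₂ _+_ (Σsub-suc n f) (Σsub-suc n g) ⟨
    Σsub (suc n) f + Σsub (suc n) g ∎
    where
    open ≡-Reasoning
    f₀ f₁ g₀ g₁ : Subset n → ℚ
    f₀ c = f (false ∷ c)
    f₁ c = f (true ∷ c)
    g₀ c = g (false ∷ c)
    g₁ c = g (true ∷ c)

  Σsub-*ˡ : ∀ n (a : ℚ) (f : Subset n → ℚ) → Σsub n (λ c → a * f c) ≡ a * Σsub n f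
  Σsub-*ˡ zero    a f = trans (Σsub-zero (λ c → a * f c)) (cong (a *_) (sym (Σsub-zero f)))
  Σsub-*ˡ (suc n) a f = trans (Σsub-suc n (λ c → a * f c)) (trans
    (cong₂ _+_ (Σsub-*ˡ n a (λ c → f (false ∷ c))) (Σsub-*ˡ n a (λ c → f (true ∷ c))))
    (trans (sym (*-distribˡ-+ a _ _)) (cong (a *_) (sym (Σsub-suc n f)))))

  Σsub-*ʳ : ∀ n (a : ℚ) (f : Subset n → ℚ) → Σsub n (λ c → f c * a) ≡ Σsub n f * a
  Σsub-*ʳ n a f = trans (Σsub-cong n (λ c → *-comm (f c) a)) (trans (Σsub-*ˡ n a f) (*-comm a (Σsub n f)))

  Σsub-0 : ∀ n {f : Subset n → ℚ} → (∀ c → f c ≡ 0ℚ) → Σsub n f ≡ 0ℚ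
  Σsub-0 n {f} f≗0 = begin
    Σsub n f                   ≡⟨ Σsub-cong n (λ c → trans (f≗0 c) (sym (*-zeroˡ 0ℚ))) ⟩
    Σsub n (λ _ → 0ℚ * 0ℚ)     ≡⟨ Σsub-*ˡ n 0ℚ (λ _ → 0ℚ) ⟩
    0ℚ * Σsub n (λ _ → 0ℚ)     ≡⟨ *-zeroˡ (Σsub n (λ _ → 0ℚ)) ⟩
    0ℚ                         ∎
    where open ≡-Reasoning

  Σsub-comm : ∀ n m (f : Subset n → Subset m → ℚ) →
    Σsub n (λ a → Σsub m (λ b → f a b)) ≡ Σsub m (λ b → Σsub n (λ a → f a b))
  Σsub-comm zero m f =
    trans (Σsub-zero (λ a → Σsub m (f a))) (Σsub-cong m (λ b → sym (Σsub-zero (λ a → f a b))))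
  Σsub-comm (suc n) m f = trans (Σsub-suc n (λ a → Σsub m (f a))) (trans
    (cong₂ _+_ (Σsub-comm n m (λ a → f (false ∷ a))) (Σsub-comm n m (λ a → f (true ∷ a))))
    (trans (sym (Σsub-+ m _ _)) (Σsub-cong m (λ b → sym (Σsub-suc n (λ a → f a b))))))

  Σsub-mono-≤ : ∀ n {f g : Subset n → ℚ} → (∀ c → f c ≤ g c) → Σsub n f ≤ Σsub n g
  Σsub-mono-≤ zero    {f} {g} f≤g = subst₂ _≤_ (sym (Σsub-zero f)) (sym (Σsub-zero g)) (f≤g [])
  Σsub-mono-≤ (suc n) {f} {g} f≤g = subst₂ _≤_ (sym (Σsub-suc n f)) (sym (Σsub-suc n g))
    (+-mono-≤ (Σsub-mono-≤ n (λ c → f≤g (false ∷ c))) (Σsub-mono-≤ n (λ c → f≤g (true ∷ c))))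

  ℕ→ℚ-count : ∀ n (P : Subset n → Bool) → ℕ→ℚ (count n P) ≡ Σsub n (λ c → 𝟙 (P c))
  ℕ→ℚ-count n P = go (allSubsets n)
    where
    go : ∀ xs → ℕ→ℚ (length (filter (λ s → T? (P s)) xs)) ≡ sumℚ (map (λ c → 𝟙 (P c)) xs)
    go []       = refl
    go (x ∷ xs) with P x
    ... | true  = trans (ℕ→ℚ-+ 1 (length (filter (λ s → T? (P s)) xs))) (cong (1ℚ +_) (go xs))
    ... | false = trans (go xs) (sym (+-identityˡ (sumℚ (map (λ c → 𝟙 (P c)) xs))))

  Σupto-cong : ∀ u {f g : ℕ → ℚ} → (∀ j → j ℕ.≤ u → f j ≡ g j) → Σupto u f ≡ Σupto u g
  Σupto-cong zero    f≗g = f≗g 0 z≤n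
  Σupto-cong (suc u) f≗g =
    cong₂ _+_ (Σupto-cong u (λ j j≤u → f≗g j (ℕₚ.m≤n⇒m≤1+n j≤u))) (f≗g (suc u) ℕₚ.≤-refl)

  Σupto-+ : ∀ u (f g : ℕ → ℚ) → Σupto u (λ j → f j + g j) ≡ Σupto u f + Σupto u g
  Σupto-+ zero    f g = refl
  Σupto-+ (suc u) f g = trans (cong (_+ (f (suc u) + g (suc u))) (Σupto-+ u f g))
    (solve 4 (λ a b c d → (a :+ b) :+ (c :+ d) := (a :+ c) :+ (b :+ d)) refl
      (Σupto u f) (Σupto u g) (f (suc u)) (g (suc u)))

  Σupto-*ˡ : ∀ u (a : ℚ) (f : ℕ → ℚ) → Σupto u (λ j → a * f j) ≡ a * Σupto u f
  Σupto-*ˡ zero    a f = refl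
  Σupto-*ˡ (suc u) a f =
    trans (cong (_+ (a * f (suc u))) (Σupto-*ˡ u a f)) (sym (*-distribˡ-+ a (Σupto u f) (f (suc u))))

  Σupto-neg : ∀ u (f : ℕ → ℚ) → Σupto u (λ j → - f j) ≡ - Σupto u f
  Σupto-neg zero    f = refl
  Σupto-neg (suc u) f =
    trans (cong (_+ - f (suc u)) (Σupto-neg u f)) (sym (neg-distrib-+ (Σupto u f) (f (suc u))))

  Σupto-suc : ∀ u (f : ℕ → ℚ) → Σupto (suc u) f ≡ f 0 + Σupto u (λ j → f (suc j))
  Σupto-suc zero    f = refl
  Σupto-suc (suc u) f = trans (cong (_+ f (suc (suc u))) (Σupto-suc u f)) (+-assoc (f 0) _ _)

  Σupto-Σsub-comm : ∀ u n (f : ℕ → Subset n → ℚ) →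
    Σupto u (λ j → Σsub n (f j)) ≡ Σsub n (λ c → Σupto u (λ j → f j c))
  Σupto-Σsub-comm zero    n f = refl
  Σupto-Σsub-comm (suc u) n f = trans (cong (_+ Σsub n (f (suc u))) (Σupto-Σsub-comm u n f))
    (sym (Σsub-+ n (λ c → Σupto u (λ j → f j c)) (f (suc u))))

  Σsub-δ : ∀ n (s : Subset n) (f : Subset n → ℚ) → Σsub n (λ t → 𝟙 (s == t) * f t) ≡ f s
  Σsub-δ zero [] f = trans (Σsub-zero (λ t → 𝟙 ([] == t) * f t)) (*-identityˡ (f []))
  Σsub-δ (suc n) (false ∷ s) f = trans (Σsub-suc n (λ t → 𝟙 ((false ∷ s) == t) * f t))
    (trans (cong₂ _+_ (Σsub-δ n s (λ t → f (false ∷ t))) (Σsub-0 n (λ t → *-zeroˡ (f (true ∷ t)))))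
      (+-identityʳ (f (false ∷ s))))
  Σsub-δ (suc n) (true ∷ s) f = trans (Σsub-suc n (λ t → 𝟙 ((true ∷ s) == t) * f t))
    (trans (cong₂ _+_ (Σsub-0 n (λ t → *-zeroˡ (f (false ∷ t)))) (Σsub-δ n s (λ t → f (true ∷ t))))
      (+-identityˡ (f (true ∷ s))))

module SubsetTests where
  open import Data.Nat as ℕ using (ℕ; zero; suc; _+_; _≤_; s≤s)
  import Data.Nat.Properties as ℕₚ
  open import Data.Bool using (true; false; _∧_; T)
  open import Data.Bool.Properties using (∧-zeroʳ)
  open import Data.Unit using (tt)
  open import Data.Vec using ([]; _∷_)
  open import Data.Fin.Subset using (Subset; _⊆_; ∣_∣; _∩_; _─_; _∪_; ⊥)
  open import Data.Fin.Subset.Properties using (_⊆?_; ⊆-trans; p⊆q⇒∣p∣≤∣q∣; ∣p∩q∣≤∣q∣)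
  open import Relation.Binary.PropositionalEquality
  open import Relation.Nullary using (yes; no)
  open import Data.Empty using (⊥-elim)

  =ℕ⇒≡ : ∀ {a b} → T (a =ℕ b) → a ≡ b
  =ℕ⇒≡ {zero}  {zero}  _ = refl
  =ℕ⇒≡ {suc a} {suc b} h = cong suc (=ℕ⇒≡ h)

  =ℕ-refl : ∀ a → (a =ℕ a) ≡ true
  =ℕ-refl zero    = refl
  =ℕ-refl (suc a) = =ℕ-refl a

  ≢⇒=ℕ-false : ∀ {a b} → a ≢ b → (a =ℕ b) ≡ false
  ≢⇒=ℕ-false {zero}  {zero}  a≢b = ⊥-elim (a≢b refl)
  ≢⇒=ℕ-false {zero}  {suc b} _   = refl
  ≢⇒=ℕ-false {suc a} {zero}  _   = refl
  ≢⇒=ℕ-false {suc a} {suc b} a≢b = ≢⇒=ℕ-false (λ a≡b → a≢b (cong suc a≡b))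

  =ℕ-sym : ∀ a b → (a =ℕ b) ≡ (b =ℕ a)
  =ℕ-sym zero    zero    = refl
  =ℕ-sym zero    (suc b) = refl
  =ℕ-sym (suc a) zero    = refl
  =ℕ-sym (suc a) (suc b) = =ℕ-sym a b

  +-=ℕ-cancelˡ : ∀ k a b → ((k + a) =ℕ (k + b)) ≡ (a =ℕ b)
  +-=ℕ-cancelˡ zero    a b = refl
  +-=ℕ-cancelˡ (suc k) a b = +-=ℕ-cancelˡ k a b

  ⊆ᵇ⇒⊆ : ∀ {n} {p q : Subset n} → T (p ⊆ᵇ q) → p ⊆ q
  ⊆ᵇ⇒⊆ {p = p} {q} h with p ⊆? q
  ... | yes p⊆q = p⊆q
  ... | no _    = ⊥-elim h

  ⊆⇒⊆ᵇ : ∀ {n} {p q : Subset n} → p ⊆ q → T (p ⊆ᵇ q)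
  ⊆⇒⊆ᵇ {p = p} {q} p⊆q with p ⊆? q
  ... | yes _   = tt
  ... | no p⊈q  = p⊈q p⊆q

  ⊆ᵇ-trans : ∀ {n} (p q r : Subset n) → T (p ⊆ᵇ q) → T (q ⊆ᵇ r) → T (p ⊆ᵇ r)
  ⊆ᵇ-trans p q r p⊆q q⊆r =
    ⊆⇒⊆ᵇ {p = p} {r} (⊆-trans (⊆ᵇ⇒⊆ {p = p} {q} p⊆q) (⊆ᵇ⇒⊆ {p = q} {r} q⊆r))

  ⊆ᵇ-∣∣-mono : ∀ {n} (p q : Subset n) → T (p ⊆ᵇ q) → ∣ p ∣ ≤ ∣ q ∣
  ⊆ᵇ-∣∣-mono p q p⊆q = p⊆q⇒∣p∣≤∣q∣ (⊆ᵇ⇒⊆ {p = p} {q} p⊆q)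

  ⊥⊆ᵇ : ∀ {n} (p : Subset n) → (⊥ ⊆ᵇ p) ≡ true
  ⊥⊆ᵇ []      = refl
  ⊥⊆ᵇ (x ∷ p) = ⊥⊆ᵇ p

  ⊆ᵇ∧∣∣≡⇒≡ : ∀ {n} (p q : Subset n) → T (p ⊆ᵇ q) → ∣ q ∣ ≡ ∣ p ∣ → p ≡ q
  ⊆ᵇ∧∣∣≡⇒≡ []          []          _ _ = refl
  ⊆ᵇ∧∣∣≡⇒≡ (false ∷ p) (false ∷ q) h e = cong (false ∷_) (⊆ᵇ∧∣∣≡⇒≡ p q h e)
  ⊆ᵇ∧∣∣≡⇒≡ (false ∷ p) (true ∷ q)  h e = ⊥-elim (ℕₚ.<-irrefl (sym e) (s≤s (⊆ᵇ-∣∣-mono p q h)))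
  ⊆ᵇ∧∣∣≡⇒≡ (true ∷ p)  (true ∷ q)  h e = cong (true ∷_) (⊆ᵇ∧∣∣≡⇒≡ p q h (ℕₚ.suc-injective e))

  ∣q─p∣+∣p∣≡∣q∣ : ∀ {n} (p q : Subset n) → T (p ⊆ᵇ q) → ∣ q ─ p ∣ + ∣ p ∣ ≡ ∣ q ∣
  ∣q─p∣+∣p∣≡∣q∣ []          []          _ = refl
  ∣q─p∣+∣p∣≡∣q∣ (false ∷ p) (false ∷ q) h = ∣q─p∣+∣p∣≡∣q∣ p q h
  ∣q─p∣+∣p∣≡∣q∣ (false ∷ p) (true ∷ q)  h = cong suc (∣q─p∣+∣p∣≡∣q∣ p q h)
  ∣q─p∣+∣p∣≡∣q∣ (true ∷ p)  (true ∷ q)  h =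
    trans (ℕₚ.+-suc ∣ q ─ p ∣ ∣ p ∣) (cong suc (∣q─p∣+∣p∣≡∣q∣ p q h))

  q─[q─p]≡p : ∀ {n} (p q : Subset n) → T (p ⊆ᵇ q) → q ─ (q ─ p) ≡ p
  q─[q─p]≡p []          []          _ = refl
  q─[q─p]≡p (false ∷ p) (false ∷ q) h = cong (false ∷_) (q─[q─p]≡p p q h)
  q─[q─p]≡p (false ∷ p) (true ∷ q)  h = cong (false ∷_) (q─[q─p]≡p p q h)
  q─[q─p]≡p (true ∷ p)  (true ∷ q)  h = cong (true ∷_) (q─[q─p]≡p p q h)

  q─p⊆ᵇq : ∀ {n} (p q : Subset n) → T ((q ─ p) ⊆ᵇ q)
  q─p⊆ᵇq []          []          = tt
  q─p⊆ᵇq (false ∷ p) (false ∷ q) = q─p⊆ᵇq p q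
  q─p⊆ᵇq (false ∷ p) (true ∷ q)  = q─p⊆ᵇq p q
  q─p⊆ᵇq (true ∷ p)  (y ∷ q)     = q─p⊆ᵇq p q

  p⊆ᵇp∪q : ∀ {n} (p q : Subset n) → T (p ⊆ᵇ (p ∪ q))
  p⊆ᵇp∪q []          []      = tt
  p⊆ᵇp∪q (false ∷ p) (y ∷ q) = p⊆ᵇp∪q p q
  p⊆ᵇp∪q (true ∷ p)  (y ∷ q) = p⊆ᵇp∪q p q

  ∪-⊆ᵇ : ∀ {n} (p q r : Subset n) → (p ⊆ᵇ r ∧ q ⊆ᵇ r) ≡ ((p ∪ q) ⊆ᵇ r)
  ∪-⊆ᵇ []          []          []          = refl
  ∪-⊆ᵇ (false ∷ p) (false ∷ q) (z ∷ r)     = ∪-⊆ᵇ p q r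
  ∪-⊆ᵇ (false ∷ p) (true ∷ q)  (false ∷ r) = ∧-zeroʳ _
  ∪-⊆ᵇ (false ∷ p) (true ∷ q)  (true ∷ r)  = ∪-⊆ᵇ p q r
  ∪-⊆ᵇ (true ∷ p)  (y ∷ q)     (false ∷ r) = refl
  ∪-⊆ᵇ (true ∷ p)  (false ∷ q) (true ∷ r)  = ∪-⊆ᵇ p q r
  ∪-⊆ᵇ (true ∷ p)  (true ∷ q)  (true ∷ r)  = ∪-⊆ᵇ p q r

  ∪-== : ∀ {n} (p q r : Subset n) → (p ⊆ᵇ r ∧ ((r ─ p) ⊆ᵇ q ∧ q ⊆ᵇ r)) ≡ ((p ∪ q) == r)
  ∪-== []          []          []          = refl
  ∪-== (false ∷ p) (false ∷ q) (false ∷ r) = ∪-== p q r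
  ∪-== (false ∷ p) (false ∷ q) (true ∷ r)  = ∧-zeroʳ _
  ∪-== (false ∷ p) (true ∷ q)  (false ∷ r) = trans (cong (p ⊆ᵇ r ∧_) (∧-zeroʳ _)) (∧-zeroʳ _)
  ∪-== (false ∷ p) (true ∷ q)  (true ∷ r)  = ∪-== p q r
  ∪-== (true ∷ p)  (y ∷ q)     (false ∷ r) = refl
  ∪-== (true ∷ p)  (false ∷ q) (true ∷ r)  = ∪-== p q r
  ∪-== (true ∷ p)  (true ∷ q)  (true ∷ r)  = ∪-== p q r

  ∣p∩q∣=ℕ∣q∣ : ∀ {n} (p q : Subset n) → (∣ p ∩ q ∣ =ℕ ∣ q ∣) ≡ (q ⊆ᵇ p)
  ∣p∩q∣=ℕ∣q∣ []          []          = refl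
  ∣p∩q∣=ℕ∣q∣ (x ∷ p)     (false ∷ q) rewrite ∧-zeroʳ x = ∣p∩q∣=ℕ∣q∣ p q
  ∣p∩q∣=ℕ∣q∣ (false ∷ p) (true ∷ q)  = ≢⇒=ℕ-false (λ e → ℕₚ.<-irrefl e (s≤s (∣p∩q∣≤∣q∣ p q)))
  ∣p∩q∣=ℕ∣q∣ (true ∷ p)  (true ∷ q)  = ∣p∩q∣=ℕ∣q∣ p q

  ==≡⊆ᵇ∧∣∣=ℕ∣∣ : ∀ {n} (p q : Subset n) → (p == q) ≡ (p ⊆ᵇ q ∧ (∣ q ∣ =ℕ ∣ p ∣))
  ==≡⊆ᵇ∧∣∣=ℕ∣∣ []          []          = refl
  ==≡⊆ᵇ∧∣∣=ℕ∣∣ (false ∷ p) (false ∷ q) = ==≡⊆ᵇ∧∣∣=ℕ∣∣ p q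
  ==≡⊆ᵇ∧∣∣=ℕ∣∣ (false ∷ p) (true ∷ q) with p ⊆ᵇ q in p⊆q
  ... | false = refl
  ... | true  = sym (≢⇒=ℕ-false (λ e → ℕₚ.<-irrefl (sym e)
                  (s≤s (⊆ᵇ-∣∣-mono p q (subst T (sym p⊆q) tt)))))
  ==≡⊆ᵇ∧∣∣=ℕ∣∣ (true ∷ p)  (false ∷ q) = refl
  ==≡⊆ᵇ∧∣∣=ℕ∣∣ (true ∷ p)  (true ∷ q)  = ==≡⊆ᵇ∧∣∣=ℕ∣∣ p q

module Binomial where
  open import Data.Nat as ℕ using (ℕ; zero; suc; _≤_; _<_; _+_; _*_; _∸_; _!)
  open import Data.Nat.Properties
  open import Data.Nat.Combinatorics
  open import Data.Nat.DivMod using (m/n*n≡m)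
  open import Relation.Binary.PropositionalEquality
  open import Relation.Binary.Definitions using (tri<; tri≈; tri>)
  open import Data.Nat.Solver using (module +-*-Solver)
  open +-*-Solver

  nCk*[k!*[n∸k]!]≡n! : ∀ {n k} → k ≤ n → (n C k) * (k ! * (n ∸ k) !) ≡ n !
  nCk*[k!*[n∸k]!]≡n! {n} {k} k≤n = trans (cong (_* (k ! * (n ∸ k) !)) (nCk≡n!/k![n-k]! k≤n))
    (m/n*n≡m {{k !* (n ∸ k) !≢0}} (k![n∸k]!∣n! k≤n))

  nCk≢0 : ∀ {n k} → k ≤ n → n C k ≢ 0
  nCk≢0 {n} {k} k≤n nCk≡0 = n!≢0 (begin
    n !                         ≡⟨ nCk*[k!*[n∸k]!]≡n! k≤n ⟨
    (n C k) * (k ! * (n ∸ k) !) ≡⟨ cong (_* (k ! * (n ∸ k) !)) nCk≡0 ⟩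
    0                           ∎)
    where
    open ≡-Reasoning
    n!≢0 : n ! ≢ 0
    n!≢0 = ℕ.≢-nonZero⁻¹ (n !) {{n !≢0}}

  [1+i]*nC[1+i]≡[n∸i]*nCi : ∀ n i → suc i * (n C suc i) ≡ (n ∸ i) * (n C i)
  [1+i]*nC[1+i]≡[n∸i]*nCi n i with <-cmp i n
  ... | tri< i<n _ _ = *-cancelʳ-≡ _ _ (i ! * (n ∸ suc i) !) {{i !* (n ∸ suc i) !≢0}} (trans lhs (sym rhs))
    where
    n∸i≡1+[n∸1+i] : n ∸ i ≡ suc (n ∸ suc i)
    n∸i≡1+[n∸1+i] = +-∸-assoc 1 i<n
    lhs : suc i * (n C suc i) * (i ! * (n ∸ suc i) !) ≡ n !
    lhs = trans (solve 4 (λ s a f g → s :* a :* (f :* g) := a :* (s :* f :* g)) refl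
                   (suc i) (n C suc i) (i !) ((n ∸ suc i) !))
                (nCk*[k!*[n∸k]!]≡n! i<n)
    rhs : (n ∸ i) * (n C i) * (i ! * (n ∸ suc i) !) ≡ n !
    rhs = trans (solve 4 (λ s b f g → s :* b :* (f :* g) := b :* (f :* (s :* g))) refl
                   (n ∸ i) (n C i) (i !) ((n ∸ suc i) !))
          (trans (cong (λ e → (n C i) * (i ! * e))
                   (trans (cong (_* (n ∸ suc i) !) n∸i≡1+[n∸1+i]) (cong _! (sym n∸i≡1+[n∸1+i]))))
                 (nCk*[k!*[n∸k]!]≡n! (<⇒≤ i<n)))
  ... | tri≈ _ refl _ rewrite k>n⇒nCk≡0 (n<1+n n) | n∸n≡0 n | *-zeroʳ (suc n) = refl
  ... | tri> _ _ n<i rewrite k>n⇒nCk≡0 (m<n⇒m<1+n n<i) | m≤n⇒m∸n≡0 (<⇒≤ n<i) | *-zeroʳ (suc i) = refl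

  -- absorption on both levels: (j+1) C(m, j+1) = (m − j) C(m, j) and
  -- (k+j+1) C(d, k+j+1) = (d − k − j) C(d, k+j)
  [1+j]*dC[k+j]*[d∸k]C[1+j]≡[d∸k]Cj*[1+k+j]*dC[1+k+j] : ∀ d k j → let m = d ∸ k in
    (suc j * (d C (k + j))) * (m C suc j) ≡ (m C j) * (suc (k + j) * (d C suc (k + j)))
  [1+j]*dC[k+j]*[d∸k]C[1+j]≡[d∸k]Cj*[1+k+j]*dC[1+k+j] d k j = begin
    (suc j * (d C (k + j))) * (m C suc j)   ≡⟨ *-assoc (suc j) (d C (k + j)) (m C suc j) ⟩
    suc j * ((d C (k + j)) * (m C suc j))   ≡⟨ cong (suc j *_) (*-comm (d C (k + j)) (m C suc j)) ⟩
    suc j * ((m C suc j) * (d C (k + j)))   ≡⟨ *-assoc (suc j) (m C suc j) (d C (k + j)) ⟨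
    (suc j * (m C suc j)) * (d C (k + j))   ≡⟨ cong (_* (d C (k + j))) ([1+i]*nC[1+i]≡[n∸i]*nCi m j) ⟩
    ((m ∸ j) * (m C j)) * (d C (k + j))     ≡⟨ cong (λ r → (r * (m C j)) * (d C (k + j))) (∸-+-assoc d k j) ⟩
    ((d ∸ (k + j)) * (m C j)) * (d C (k + j))
      ≡⟨ cong (_* (d C (k + j))) (*-comm (d ∸ (k + j)) (m C j)) ⟩
    ((m C j) * (d ∸ (k + j))) * (d C (k + j)) ≡⟨ *-assoc (m C j) (d ∸ (k + j)) (d C (k + j)) ⟩
    (m C j) * ((d ∸ (k + j)) * (d C (k + j))) ≡⟨ cong ((m C j) *_) ([1+i]*nC[1+i]≡[n∸i]*nCi d (k + j)) ⟨
    (m C j) * (suc (k + j) * (d C suc (k + j))) ∎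
    where
    open ≡-Reasoning
    m = d ∸ k

  [k+r]Ck*[k!*r!]≡[k+r]! : ∀ k r → ((k + r) C k) * (k ! * r !) ≡ (k + r) !
  [k+r]Ck*[k!*r!]≡[k+r]! k r =
    trans (cong (λ e → ((k + r) C k) * (k ! * e !)) (sym (m+n∸m≡n k r))) (nCk*[k!*[n∸k]!]≡n! (m≤m+n k r))

  -- both sides are (δ + b + c) ! / (δ ! * b ! * c !)
  [δ+b+c]C[δ+b]*[δ+b]Cδ≡[δ+b+c]Cδ*[b+c]Cb : ∀ δ b c →
    ((δ + b + c) C (δ + b)) * ((δ + b) C δ) ≡ ((δ + (b + c)) C δ) * ((b + c) C b)
  [δ+b+c]C[δ+b]*[δ+b]Cδ≡[δ+b+c]Cδ*[b+c]Cb δ b c = *-cancelʳ-≡ _ _ (δ ! * b ! * c !)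
      {{m*n≢0 (δ ! * b !) (c !) {{δ !* b !≢0}} {{c !≢0}}}} (trans lhs (sym rhs))
    where
    open ≡-Reasoning
    lhs : ((δ + b + c) C (δ + b)) * ((δ + b) C δ) * (δ ! * b ! * c !) ≡ (δ + (b + c)) !
    lhs = begin
      ((δ + b + c) C (δ + b)) * ((δ + b) C δ) * (δ ! * b ! * c !)
        ≡⟨ solve 5 (λ z w d b c → z :* w :* (d :* b :* c) := z :* ((w :* (d :* b)) :* c)) refl
             ((δ + b + c) C (δ + b)) ((δ + b) C δ) (δ !) (b !) (c !) ⟩
      ((δ + b + c) C (δ + b)) * ((((δ + b) C δ) * (δ ! * b !)) * c !)
        ≡⟨ cong (λ e → ((δ + b + c) C (δ + b)) * (e * c !)) ([k+r]Ck*[k!*r!]≡[k+r]! δ b) ⟩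
      ((δ + b + c) C (δ + b)) * ((δ + b) ! * c !)
        ≡⟨ [k+r]Ck*[k!*r!]≡[k+r]! (δ + b) c ⟩
      ((δ + b + c) !)
        ≡⟨ cong _! (+-assoc δ b c) ⟩
      ((δ + (b + c)) !) ∎
    rhs : ((δ + (b + c)) C δ) * ((b + c) C b) * (δ ! * b ! * c !) ≡ (δ + (b + c)) !
    rhs = begin
      ((δ + (b + c)) C δ) * ((b + c) C b) * (δ ! * b ! * c !)
        ≡⟨ solve 5 (λ y x d b c → y :* x :* (d :* b :* c) := y :* (d :* (x :* (b :* c)))) refl
             ((δ + (b + c)) C δ) ((b + c) C b) (δ !) (b !) (c !) ⟩
      ((δ + (b + c)) C δ) * (δ ! * (((b + c) C b) * (b ! * c !)))
        ≡⟨ cong (λ e → ((δ + (b + c)) C δ) * (δ ! * e)) ([k+r]Ck*[k!*r!]≡[k+r]! b c) ⟩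
      ((δ + (b + c)) C δ) * (δ ! * (b + c) !)
        ≡⟨ [k+r]Ck*[k!*r!]≡[k+r]! δ (b + c) ⟩
      ((δ + (b + c)) !) ∎

  mCj*jCδ≡mCδ*[m∸δ]C[j∸δ] : ∀ {m j δ} → δ ≤ j → j ≤ m → (m C j) * (j C δ) ≡ (m C δ) * ((m ∸ δ) C (j ∸ δ))
  mCj*jCδ≡mCδ*[m∸δ]C[j∸δ] {m} {j} {δ} δ≤j j≤m = begin
    (m C j) * (j C δ)
      ≡⟨ cong₂ (λ x y → (x C y) * (y C δ)) m≡δ+b+c j≡δ+b ⟩
    ((δ + b + c) C (δ + b)) * ((δ + b) C δ)
      ≡⟨ [δ+b+c]C[δ+b]*[δ+b]Cδ≡[δ+b+c]Cδ*[b+c]Cb δ b c ⟩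
    ((δ + (b + c)) C δ) * ((b + c) C b)
      ≡⟨ cong₂ (λ x y → (x C δ) * (y C b)) (trans (sym (+-assoc δ b c)) (sym m≡δ+b+c)) b+c≡m∸δ ⟩
    (m C δ) * ((m ∸ δ) C (j ∸ δ)) ∎
    where
    open ≡-Reasoning
    b c : ℕ
    b = j ∸ δ
    c = m ∸ j
    j≡δ+b : j ≡ δ + b
    j≡δ+b = sym (m+[n∸m]≡n δ≤j)
    m≡δ+b+c : m ≡ δ + b + c
    m≡δ+b+c = trans (sym (m+[n∸m]≡n j≤m)) (cong (_+ c) j≡δ+b)
    b+c≡m∸δ : b + c ≡ m ∸ δ
    b+c≡m∸δ = trans (sym (m+n∸m≡n δ (b + c))) (cong (_∸ δ) (trans (sym (+-assoc δ b c)) (sym m≡δ+b+c)))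

module IntervalCount where
  open import Data.Nat as ℕ using (ℕ; zero; suc; _<_; s≤s)
  import Data.Nat.Properties as ℕₚ
  open import Data.Nat.Combinatorics using (_C_; nCk+nC[k+1]≡[n+1]C[k+1])
  open import Data.Bool using (Bool; true; false; _∧_; T)
  open import Data.Bool.Properties using (∧-zeroʳ)
  open import Data.Unit using (tt)
  open import Data.Vec using ([]; _∷_)
  open import Data.Fin.Subset using (Subset; ∣_∣; _─_; ⊥)
  open import Data.Fin.Subset.Properties using (∣⊥∣≡0; p─⊥≡p)
  open import Data.Rational using (ℚ; 0ℚ; _+_; _*_)
  open import Data.Rational.Properties using (+-identityˡ; +-identityʳ; *-identityˡ; *-zeroˡ)
  open import Relation.Binary.PropositionalEquality
  open ℚ-Arithmetic using (ℕ→ℚ-+; 1/₀_; ÷₀≡*1/₀; 𝟙-∧)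
  open Sums
  open SubsetTests

  lag : (ℕ → ℕ) → ℕ → ℕ
  lag f zero    = 0
  lag f (suc i) = f i

  -- shiftedC b a i = a C (i ∸ b) for b ≤ i, and 0 for i < b
  shiftedC : ℕ → ℕ → ℕ → ℕ
  shiftedC zero    a i       = a C i
  shiftedC (suc b) a zero    = 0
  shiftedC (suc b) a (suc i) = shiftedC b a i

  shiftedC-suc : ∀ b a i → shiftedC (suc b) a i ≡ lag (shiftedC b a) i
  shiftedC-suc b a zero    = refl
  shiftedC-suc b a (suc i) = refl

  shiftedC-pascal : ∀ b a i → shiftedC b (suc a) i ≡ shiftedC b a i ℕ.+ lag (shiftedC b a) i
  shiftedC-pascal zero    a zero    = refl
  shiftedC-pascal zero    a (suc i) =
    trans (sym (nCk+nC[k+1]≡[n+1]C[k+1] a i)) (ℕₚ.+-comm (a C i) (a C suc i))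
  shiftedC-pascal (suc b) a zero    = refl
  shiftedC-pascal (suc b) a (suc i) =
    trans (shiftedC-pascal b a i) (cong (shiftedC b a i ℕ.+_) (sym (shiftedC-suc b a i)))

  shiftedC-+ : ∀ b a j → shiftedC b a (b ℕ.+ j) ≡ a C j
  shiftedC-+ zero    a j = refl
  shiftedC-+ (suc b) a j = shiftedC-+ b a j

  shiftedC-+-+ : ∀ k b a j → shiftedC (k ℕ.+ b) a (k ℕ.+ j) ≡ shiftedC b a j
  shiftedC-+-+ zero    b a j = refl
  shiftedC-+-+ (suc k) b a j = shiftedC-+-+ k b a j

  shiftedC-< : ∀ b a j → j < b → shiftedC b a j ≡ 0
  shiftedC-< (suc b) a zero    _         = refl
  shiftedC-< (suc b) a (suc j) (s≤s j<b) = shiftedC-< b a j j<b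

  inInterval : ∀ {n} → Subset n → Subset n → ℕ → Subset n → Bool
  inInterval lo hi i c = (lo ⊆ᵇ c ∧ c ⊆ᵇ hi) ∧ (∣ c ∣ =ℕ i)

  𝟙-inInterval : ∀ {n} (lo hi : Subset n) i c →
    𝟙 (inInterval lo hi i c) ≡ 𝟙 (lo ⊆ᵇ c) * 𝟙 (c ⊆ᵇ hi) * 𝟙 (∣ c ∣ =ℕ i)
  𝟙-inInterval lo hi i c =
    trans (𝟙-∧ (lo ⊆ᵇ c ∧ c ⊆ᵇ hi) (∣ c ∣ =ℕ i)) (cong (_* 𝟙 (∣ c ∣ =ℕ i)) (𝟙-∧ (lo ⊆ᵇ c) (c ⊆ᵇ hi)))

  Σsub-𝟙-false : ∀ n {P : Subset n → Bool} → (∀ c → P c ≡ false) → Σsub n (λ c → 𝟙 (P c)) ≡ 0ℚ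
  Σsub-𝟙-false n P≗false = Σsub-0 n (λ c → cong 𝟙 (P≗false c))

  Σsub-inInterval : ∀ n (lo hi : Subset n) → T (lo ⊆ᵇ hi) → ∀ i →
    Σsub n (λ c → 𝟙 (inInterval lo hi i c)) ≡ ℕ→ℚ (shiftedC ∣ lo ∣ ∣ hi ─ lo ∣ i)
  Σsub-inInterval zero [] [] _ zero    = refl
  Σsub-inInterval zero [] [] _ (suc i) = refl
  Σsub-inInterval (suc n) (false ∷ lo) (false ∷ hi) lo⊆hi i = begin
    Σsub (suc n) (λ c → 𝟙 (inInterval (false ∷ lo) (false ∷ hi) i c))
      ≡⟨ Σsub-suc n (λ c → 𝟙 (inInterval (false ∷ lo) (false ∷ hi) i c)) ⟩
    Σsub n (λ c → 𝟙 (inInterval lo hi i c)) + Σsub n (λ c → 𝟙 (inInterval (false ∷ lo) (false ∷ hi) i (true ∷ c)))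
      ≡⟨ cong₂ _+_ (Σsub-inInterval n lo hi lo⊆hi i)
                   (Σsub-𝟙-false n (λ c → cong (_∧ (suc ∣ c ∣ =ℕ i)) (∧-zeroʳ (lo ⊆ᵇ c)))) ⟩
    ℕ→ℚ (shiftedC ∣ lo ∣ ∣ hi ─ lo ∣ i) + 0ℚ
      ≡⟨ +-identityʳ (ℕ→ℚ (shiftedC ∣ lo ∣ ∣ hi ─ lo ∣ i)) ⟩
    ℕ→ℚ (shiftedC ∣ lo ∣ ∣ hi ─ lo ∣ i) ∎
    where open ≡-Reasoning
  Σsub-inInterval (suc n) (false ∷ lo) (true ∷ hi) lo⊆hi i = begin
    Σsub (suc n) (λ c → 𝟙 (inInterval (false ∷ lo) (true ∷ hi) i c))
      ≡⟨ Σsub-suc n (λ c → 𝟙 (inInterval (false ∷ lo) (true ∷ hi) i c)) ⟩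
    Σsub n (λ c → 𝟙 (inInterval lo hi i c)) + Σsub n (λ c → 𝟙 (inInterval (false ∷ lo) (true ∷ hi) i (true ∷ c)))
      ≡⟨ cong₂ _+_ (Σsub-inInterval n lo hi lo⊆hi i) (with-first-vertex i) ⟩
    ℕ→ℚ (shiftedC ∣ lo ∣ ∣ hi ─ lo ∣ i) + ℕ→ℚ (lag (shiftedC ∣ lo ∣ ∣ hi ─ lo ∣) i)
      ≡⟨ ℕ→ℚ-+ (shiftedC ∣ lo ∣ ∣ hi ─ lo ∣ i) (lag (shiftedC ∣ lo ∣ ∣ hi ─ lo ∣) i) ⟨
    ℕ→ℚ (shiftedC ∣ lo ∣ ∣ hi ─ lo ∣ i ℕ.+ lag (shiftedC ∣ lo ∣ ∣ hi ─ lo ∣) i)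
      ≡⟨ cong ℕ→ℚ (shiftedC-pascal ∣ lo ∣ ∣ hi ─ lo ∣ i) ⟨
    ℕ→ℚ (shiftedC ∣ lo ∣ (suc ∣ hi ─ lo ∣) i) ∎
    where
    open ≡-Reasoning
    with-first-vertex : ∀ i → Σsub n (λ c → 𝟙 (inInterval (false ∷ lo) (true ∷ hi) i (true ∷ c)))
                                ≡ ℕ→ℚ (lag (shiftedC ∣ lo ∣ ∣ hi ─ lo ∣) i)
    with-first-vertex zero    = Σsub-𝟙-false n (λ c → ∧-zeroʳ (lo ⊆ᵇ c ∧ c ⊆ᵇ hi))
    with-first-vertex (suc i) = Σsub-inInterval n lo hi lo⊆hi i
  Σsub-inInterval (suc n) (true ∷ lo) (true ∷ hi) lo⊆hi i = begin
    Σsub (suc n) (λ c → 𝟙 (inInterval (true ∷ lo) (true ∷ hi) i c))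
      ≡⟨ Σsub-suc n (λ c → 𝟙 (inInterval (true ∷ lo) (true ∷ hi) i c)) ⟩
    Σsub n (λ c → 𝟙 (inInterval (true ∷ lo) (true ∷ hi) i (false ∷ c)))
      + Σsub n (λ c → 𝟙 (inInterval (true ∷ lo) (true ∷ hi) i (true ∷ c)))
      ≡⟨ cong₂ _+_ (Σsub-𝟙-false n (λ c → refl)) (with-first-vertex i) ⟩
    0ℚ + ℕ→ℚ (lag (shiftedC ∣ lo ∣ ∣ hi ─ lo ∣) i)
      ≡⟨ +-identityˡ (ℕ→ℚ (lag (shiftedC ∣ lo ∣ ∣ hi ─ lo ∣) i)) ⟩
    ℕ→ℚ (lag (shiftedC ∣ lo ∣ ∣ hi ─ lo ∣) i)
      ≡⟨ cong ℕ→ℚ (shiftedC-suc ∣ lo ∣ ∣ hi ─ lo ∣ i) ⟨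
    ℕ→ℚ (shiftedC (suc ∣ lo ∣) ∣ hi ─ lo ∣ i) ∎
    where
    open ≡-Reasoning
    with-first-vertex : ∀ i → Σsub n (λ c → 𝟙 (inInterval (true ∷ lo) (true ∷ hi) i (true ∷ c)))
                                ≡ ℕ→ℚ (lag (shiftedC ∣ lo ∣ ∣ hi ─ lo ∣) i)
    with-first-vertex zero    = Σsub-𝟙-false n (λ c → ∧-zeroʳ (lo ⊆ᵇ c ∧ c ⊆ᵇ hi))
    with-first-vertex (suc i) = Σsub-inInterval n lo hi lo⊆hi i

  Σsub-inInterval-𝟙 : ∀ n (lo hi : Subset n) i →
    Σsub n (λ c → 𝟙 (inInterval lo hi i c)) ≡ 𝟙 (lo ⊆ᵇ hi) * ℕ→ℚ (shiftedC ∣ lo ∣ ∣ hi ─ lo ∣ i)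
  Σsub-inInterval-𝟙 n lo hi i with lo ⊆ᵇ hi in lo⊆hi
  ... | true  = trans (Σsub-inInterval n lo hi (subst T (sym lo⊆hi) tt) i)
                      (sym (*-identityˡ (ℕ→ℚ (shiftedC ∣ lo ∣ ∣ hi ─ lo ∣ i))))
  ... | false = trans (Σsub-𝟙-false n empty) (sym (*-zeroˡ (ℕ→ℚ (shiftedC ∣ lo ∣ ∣ hi ─ lo ∣ i))))
    where
    empty : ∀ c → inInterval lo hi i c ≡ false
    empty c with lo ⊆ᵇ c in lo⊆c | c ⊆ᵇ hi in c⊆hi
    ... | false | _     = refl
    ... | true  | false = refl
    ... | true  | true  = ⊥-elim (subst T lo⊆hi
          (⊆ᵇ-trans lo c hi (subst T (sym lo⊆c) tt) (subst T (sym c⊆hi) tt)))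
      where open import Data.Empty using (⊥-elim)

  ℕ→ℚ-count-⊆ᵇ : ∀ n (t : Subset n) i →
    ℕ→ℚ (count n (λ c → (c ⊆ᵇ t) ∧ (∣ c ∣ =ℕ i))) ≡ ℕ→ℚ (∣ t ∣ C i)
  ℕ→ℚ-count-⊆ᵇ n t i = begin
    ℕ→ℚ (count n (λ c → (c ⊆ᵇ t) ∧ (∣ c ∣ =ℕ i)))
      ≡⟨ ℕ→ℚ-count n _ ⟩
    Σsub n (λ c → 𝟙 ((c ⊆ᵇ t) ∧ (∣ c ∣ =ℕ i)))
      ≡⟨ Σsub-cong n (λ c → cong (λ b → 𝟙 ((b ∧ (c ⊆ᵇ t)) ∧ (∣ c ∣ =ℕ i))) (⊥⊆ᵇ c)) ⟨
    Σsub n (λ c → 𝟙 (inInterval ⊥ t i c))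
      ≡⟨ Σsub-inInterval n ⊥ t (subst T (sym (⊥⊆ᵇ t)) tt) i ⟩
    ℕ→ℚ (shiftedC ∣ ⊥ {n} ∣ ∣ t ─ ⊥ ∣ i)
      ≡⟨ cong ℕ→ℚ (cong₂ (λ b a → shiftedC b a i) (∣⊥∣≡0 n) (cong ∣_∣ (p─⊥≡p t))) ⟩
    ℕ→ℚ (∣ t ∣ C i) ∎
    where open ≡-Reasoning

  uniform-⊆ᵇ : ∀ n (t b : Subset n) i → uniform n (λ c → (c ⊆ᵇ t) ∧ (∣ c ∣ =ℕ i)) b
                                      ≡ 𝟙 ((b ⊆ᵇ t) ∧ (∣ b ∣ =ℕ i)) * 1/₀ ℕ→ℚ (∣ t ∣ C i)
  uniform-⊆ᵇ n t b i = trans (÷₀≡*1/₀ (𝟙 ((b ⊆ᵇ t) ∧ (∣ b ∣ =ℕ i))) (ℕ→ℚ (count n (λ c → (c ⊆ᵇ t) ∧ (∣ c ∣ =ℕ i)))))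
    (cong (λ c → 𝟙 ((b ⊆ᵇ t) ∧ (∣ b ∣ =ℕ i)) * 1/₀ c) (ℕ→ℚ-count-⊆ᵇ n t i))

module FiniteDifference where
  open import Data.Nat as ℕ using (ℕ; zero; suc; _≤_; _∸_)
  import Data.Nat.Properties as ℕₚ
  open import Data.Nat.Combinatorics using (_C_; k>n⇒nCk≡0; nCk+nC[k+1]≡[n+1]C[k+1])
  open import Data.Bool using (true; false; T)
  open import Data.Fin.Subset using (Subset)
  open import Data.Unit using (tt)
  open import Data.Rational using (ℚ; 0ℚ; 1ℚ; _+_; _*_; -_)
  open import Data.Rational.Properties using (*-distribˡ-+; *-comm; *-zeroˡ; *-zeroʳ; +-inverseʳ)
  open import Relation.Binary.PropositionalEquality
  open import Relation.Nullary using (Dec; yes; no)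
  open import Data.Rational.Solver
  open +-*-Solver
  open ℚ-Arithmetic
  open Sums
  open SubsetTests using (=ℕ⇒≡)
  open Binomial
  open IntervalCount using (lag; shiftedC; shiftedC-pascal; shiftedC-+; shiftedC-<)

  Δ : ℕ → (ℕ → ℚ) → ℚ
  Δ u f = Σupto u (λ j → sgn (u ∸ j) * ℕ→ℚ (u C j) * f j)

  Δ-cong : ∀ u {f g : ℕ → ℚ} → (∀ j → j ≤ u → f j ≡ g j) → Δ u f ≡ Δ u g
  Δ-cong u f≗g = Σupto-cong u (λ j j≤u → cong (sgn (u ∸ j) * ℕ→ℚ (u C j) *_) (f≗g j j≤u))

  Δ-+ : ∀ u (f g : ℕ → ℚ) → Δ u (λ j → f j + g j) ≡ Δ u f + Δ u g
  Δ-+ u f g = trans (Σupto-cong u (λ j _ → *-distribˡ-+ (sgn (u ∸ j) * ℕ→ℚ (u C j)) (f j) (g j)))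
    (Σupto-+ u _ _)

  Δ-*ʳ : ∀ u (f : ℕ → ℚ) a → Δ u (λ j → f j * a) ≡ Δ u f * a
  Δ-*ʳ u f a = begin
    Δ u (λ j → f j * a)                                   ≡⟨ Σupto-cong u (λ j _ → reorder j) ⟩
    Σupto u (λ j → a * (sgn (u ∸ j) * ℕ→ℚ (u C j) * f j)) ≡⟨ Σupto-*ˡ u a _ ⟩
    a * Δ u f                                             ≡⟨ *-comm a (Δ u f) ⟩
    Δ u f * a                                             ∎
    where
    open ≡-Reasoning
    reorder : ∀ j → sgn (u ∸ j) * ℕ→ℚ (u C j) * (f j * a) ≡ a * (sgn (u ∸ j) * ℕ→ℚ (u C j) * f j)
    reorder j = solve 4 (λ s c x a → s :* c :* (x :* a) := a :* (s :* c :* x)) refl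
      (sgn (u ∸ j)) (ℕ→ℚ (u C j)) (f j) a

  Δ-*ˡ : ∀ u a (f : ℕ → ℚ) → Δ u (λ j → a * f j) ≡ a * Δ u f
  Δ-*ˡ u a f = begin
    Δ u (λ j → a * f j)  ≡⟨ Δ-cong u (λ j _ → *-comm a (f j)) ⟩
    Δ u (λ j → f j * a)  ≡⟨ Δ-*ʳ u f a ⟩
    Δ u f * a            ≡⟨ *-comm (Δ u f) a ⟩
    a * Δ u f            ∎
    where open ≡-Reasoning

  Δ-Σsub-comm : ∀ u n (f : ℕ → Subset n → ℚ) → Δ u (λ j → Σsub n (f j)) ≡ Σsub n (λ c → Δ u (λ j → f j c))
  Δ-Σsub-comm u n f = begin
    Δ u (λ j → Σsub n (f j))
      ≡⟨ Σupto-cong u (λ j _ → Σsub-*ˡ n (sgn (u ∸ j) * ℕ→ℚ (u C j)) (f j)) ⟨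
    Σupto u (λ j → Σsub n (λ c → sgn (u ∸ j) * ℕ→ℚ (u C j) * f j c))
      ≡⟨ Σupto-Σsub-comm u n (λ j c → sgn (u ∸ j) * ℕ→ℚ (u C j) * f j c) ⟩
    Σsub n (λ c → Δ u (λ j → f j c)) ∎
    where open ≡-Reasoning

  -- Pascal's rule splits each coefficient; the two halves are Δ u of f ∘ suc and of -f
  Δ-suc : ∀ u f → Δ (suc u) f ≡ Δ u (λ j → f (suc j)) + - Δ u f
  Δ-suc u f = begin
    Δ (suc u) f                                        ≡⟨ Σupto-cong (suc u) (λ j _ → pascal j) ⟩
    Σupto (suc u) (λ j → A j + B j)                    ≡⟨ Σupto-+ (suc u) A B ⟩
    (Σupto u A + A (suc u)) + Σupto (suc u) B          ≡⟨ cong₂ _+_ (cong₂ _+_ ΣA A[1+u]≡0) (Σupto-suc u B) ⟩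
    (- Δ u f + 0ℚ) + (B 0 + Δ u (λ j → f (suc j)))     ≡⟨ cong (λ b → (- Δ u f + 0ℚ) + (b + Δ u (λ j → f (suc j)))) B0≡0 ⟩
    (- Δ u f + 0ℚ) + (0ℚ + Δ u (λ j → f (suc j)))
      ≡⟨ solve 2 (λ x y → (:- x :+ con 0ℚ) :+ (con 0ℚ :+ y) := y :+ (:- x)) refl (Δ u f) (Δ u (λ j → f (suc j))) ⟩
    Δ u (λ j → f (suc j)) + - Δ u f                    ∎
    where
    open ≡-Reasoning
    A B : ℕ → ℚ
    A j = sgn (suc u ∸ j) * ℕ→ℚ (u C j) * f j
    B j = sgn (suc u ∸ j) * ℕ→ℚ (lag (u C_) j) * f j
    pascal : ∀ j → sgn (suc u ∸ j) * ℕ→ℚ (suc u C j) * f j ≡ A j + B j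
    pascal j = trans (cong (λ c → sgn (suc u ∸ j) * c * f j)
                       (trans (cong ℕ→ℚ (shiftedC-pascal 0 u j)) (ℕ→ℚ-+ (u C j) (lag (u C_) j))))
      (solve 4 (λ s a b x → s :* (a :+ b) :* x := s :* a :* x :+ s :* b :* x) refl
        (sgn (suc u ∸ j)) (ℕ→ℚ (u C j)) (ℕ→ℚ (lag (u C_) j)) (f j))
    ΣA : Σupto u A ≡ - Δ u f
    ΣA = trans (Σupto-cong u (λ j j≤u →
           trans (cong (λ e → sgn e * ℕ→ℚ (u C j) * f j) (ℕₚ.+-∸-assoc 1 j≤u))
                 (solve 3 (λ s a x → (:- s) :* a :* x := :- (s :* a :* x)) refl
                   (sgn (u ∸ j)) (ℕ→ℚ (u C j)) (f j))))
         (Σupto-neg u (λ j → sgn (u ∸ j) * ℕ→ℚ (u C j) * f j))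
    A[1+u]≡0 : A (suc u) ≡ 0ℚ
    A[1+u]≡0 = trans (cong (λ c → sgn (suc u ∸ suc u) * ℕ→ℚ c * f (suc u)) (k>n⇒nCk≡0 (ℕₚ.n<1+n u)))
      (solve 2 (λ s x → s :* con 0ℚ :* x := con 0ℚ) refl (sgn (suc u ∸ suc u)) (f (suc u)))
    B0≡0 : B 0 ≡ 0ℚ
    B0≡0 = solve 2 (λ s x → s :* con 0ℚ :* x := con 0ℚ) refl (sgn (suc u)) (f 0)

  Δ-C : ∀ u δ → Δ u (λ j → ℕ→ℚ (j C δ)) ≡ 𝟙 (u =ℕ δ)
  Δ-C zero    zero     = refl
  Δ-C zero    (suc δ)  = refl
  Δ-C (suc u) zero     = trans (Δ-suc u _) (+-inverseʳ (Δ u (λ j → ℕ→ℚ (j C 0))))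
  Δ-C (suc u) (suc δ)  = begin
    Δ (suc u) F                                          ≡⟨ Δ-suc u F ⟩
    Δ u (λ j → F (suc j)) + - Δ u F                      ≡⟨ cong (_+ - Δ u F) (Δ-cong u (λ j _ → pascal j)) ⟩
    Δ u (λ j → ℕ→ℚ (j C δ) + F j) + - Δ u F              ≡⟨ cong (_+ - Δ u F) (Δ-+ u _ F) ⟩
    (Δ u (λ j → ℕ→ℚ (j C δ)) + Δ u F) + - Δ u F
      ≡⟨ solve 2 (λ x y → (x :+ y) :+ (:- y) := x) refl (Δ u (λ j → ℕ→ℚ (j C δ))) (Δ u F) ⟩
    Δ u (λ j → ℕ→ℚ (j C δ))                              ≡⟨ Δ-C u δ ⟩
    𝟙 (u =ℕ δ)                                           ∎
    where
    open ≡-Reasoning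
    F : ℕ → ℚ
    F j = ℕ→ℚ (j C suc δ)
    pascal : ∀ j → F (suc j) ≡ ℕ→ℚ (j C δ) + F j
    pascal j = trans (cong ℕ→ℚ (sym (nCk+nC[k+1]≡[n+1]C[k+1] j δ))) (ℕ→ℚ-+ (j C δ) (j C suc δ))

  ℕ→ℚ-C≢0 : ∀ {n k} → k ≤ n → ℕ→ℚ (n C k) ≢ 0ℚ
  ℕ→ℚ-C≢0 k≤n = ℕ→ℚ-≢0 (nCk≢0 k≤n)

  -- the number of j-sets between a fixed δ-set and a fixed m-set, relative to all j-subsets
  shiftedC/C : ∀ m δ j → j ≤ m →
    1/₀ ℕ→ℚ (m C j) * ℕ→ℚ (shiftedC δ (m ∸ δ) j) ≡ ℕ→ℚ (j C δ) * 1/₀ ℕ→ℚ (m C δ)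
  shiftedC/C m δ j j≤m = by-cases (j ℕₚ.<? δ)
    where
    open ≡-Reasoning
    by-cases : Dec (j ℕ.< δ) →
      1/₀ ℕ→ℚ (m C j) * ℕ→ℚ (shiftedC δ (m ∸ δ) j) ≡ ℕ→ℚ (j C δ) * 1/₀ ℕ→ℚ (m C δ)
    by-cases (yes j<δ) = begin
      1/₀ ℕ→ℚ (m C j) * ℕ→ℚ (shiftedC δ (m ∸ δ) j) ≡⟨ cong (λ c → 1/₀ ℕ→ℚ (m C j) * ℕ→ℚ c) (shiftedC-< δ (m ∸ δ) j j<δ) ⟩
      1/₀ ℕ→ℚ (m C j) * 0ℚ                          ≡⟨ *-zeroʳ (1/₀ ℕ→ℚ (m C j)) ⟩
      0ℚ                                            ≡⟨ *-zeroˡ (1/₀ ℕ→ℚ (m C δ)) ⟨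
      0ℚ * 1/₀ ℕ→ℚ (m C δ)                          ≡⟨ cong (λ c → ℕ→ℚ c * 1/₀ ℕ→ℚ (m C δ)) (k>n⇒nCk≡0 j<δ) ⟨
      ℕ→ℚ (j C δ) * 1/₀ ℕ→ℚ (m C δ)                 ∎
    by-cases (no j≮δ) = begin
      1/₀ ℕ→ℚ (m C j) * ℕ→ℚ (shiftedC δ (m ∸ δ) j)  ≡⟨ cong (λ c → 1/₀ ℕ→ℚ (m C j) * ℕ→ℚ c) shifted ⟩
      1/₀ ℕ→ℚ (m C j) * ℕ→ℚ (m∸δ C j∸δ)             ≡⟨ *-comm (1/₀ ℕ→ℚ (m C j)) (ℕ→ℚ (m∸δ C j∸δ)) ⟩
      ℕ→ℚ (m∸δ C j∸δ) * 1/₀ ℕ→ℚ (m C j)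
        ≡⟨ *-1/₀-cross (ℕ→ℚ (m C j)) (ℕ→ℚ (m∸δ C j∸δ)) (ℕ→ℚ (j C δ)) (ℕ→ℚ (m C δ))
                       (ℕ→ℚ-C≢0 j≤m) (ℕ→ℚ-C≢0 δ≤m) cross ⟩
      ℕ→ℚ (j C δ) * 1/₀ ℕ→ℚ (m C δ)                 ∎
      where
      m∸δ j∸δ : ℕ
      m∸δ = m ∸ δ
      j∸δ = j ∸ δ
      δ≤j : δ ≤ j
      δ≤j = ℕₚ.≮⇒≥ j≮δ
      δ≤m : δ ≤ m
      δ≤m = ℕₚ.≤-trans δ≤j j≤m
      shifted : shiftedC δ m∸δ j ≡ m∸δ C j∸δ
      shifted = trans (cong (shiftedC δ m∸δ) (sym (ℕₚ.m+[n∸m]≡n δ≤j))) (shiftedC-+ δ m∸δ j∸δ)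
      cross : ℕ→ℚ (m∸δ C j∸δ) * ℕ→ℚ (m C δ) ≡ ℕ→ℚ (m C j) * ℕ→ℚ (j C δ)
      cross = begin
        ℕ→ℚ (m∸δ C j∸δ) * ℕ→ℚ (m C δ)      ≡⟨ ℕ→ℚ-* (m∸δ C j∸δ) (m C δ) ⟨
        ℕ→ℚ ((m∸δ C j∸δ) ℕ.* (m C δ))      ≡⟨ cong ℕ→ℚ (ℕₚ.*-comm (m∸δ C j∸δ) (m C δ)) ⟩
        ℕ→ℚ ((m C δ) ℕ.* (m∸δ C j∸δ))      ≡⟨ cong ℕ→ℚ (mCj*jCδ≡mCδ*[m∸δ]C[j∸δ] δ≤j j≤m) ⟨
        ℕ→ℚ ((m C j) ℕ.* (j C δ))          ≡⟨ ℕ→ℚ-* (m C j) (j C δ) ⟩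
        ℕ→ℚ (m C j) * ℕ→ℚ (j C δ)          ∎

  Δ-shiftedC/C : ∀ m δ u → u ≤ m →
    Δ u (λ j → 1/₀ ℕ→ℚ (m C j) * ℕ→ℚ (shiftedC δ (m ∸ δ) j)) ≡ 𝟙 (u =ℕ δ) * 1/₀ ℕ→ℚ (m C u)
  Δ-shiftedC/C m δ u u≤m = begin
    Δ u (λ j → 1/₀ ℕ→ℚ (m C j) * ℕ→ℚ (shiftedC δ (m ∸ δ) j))
      ≡⟨ Δ-cong u (λ j j≤u → shiftedC/C m δ j (ℕₚ.≤-trans j≤u u≤m)) ⟩
    Δ u (λ j → ℕ→ℚ (j C δ) * 1/₀ ℕ→ℚ (m C δ))  ≡⟨ Δ-*ʳ u (λ j → ℕ→ℚ (j C δ)) (1/₀ ℕ→ℚ (m C δ)) ⟩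
    Δ u (λ j → ℕ→ℚ (j C δ)) * 1/₀ ℕ→ℚ (m C δ)  ≡⟨ cong (_* 1/₀ ℕ→ℚ (m C δ)) (Δ-C u δ) ⟩
    𝟙 (u =ℕ δ) * 1/₀ ℕ→ℚ (m C δ)               ≡⟨ only-u≡δ (u =ℕ δ) refl ⟩
    𝟙 (u =ℕ δ) * 1/₀ ℕ→ℚ (m C u)               ∎
    where
    open ≡-Reasoning
    only-u≡δ : ∀ b → (u =ℕ δ) ≡ b → 𝟙 b * 1/₀ ℕ→ℚ (m C δ) ≡ 𝟙 b * 1/₀ ℕ→ℚ (m C u)
    only-u≡δ true  u=δ = cong (λ i → 1ℚ * 1/₀ ℕ→ℚ (m C i)) (sym (=ℕ⇒≡ {u} {δ} (subst T (sym u=δ) tt)))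
    only-u≡δ false _   = trans (*-zeroˡ (1/₀ ℕ→ℚ (m C δ))) (sym (*-zeroˡ (1/₀ ℕ→ℚ (m C u))))

module FaceMass (n d : ℕ) (X : Subset n → Bool) (Πd : Subset n → ℚ)
                (X-closed : DownwardClosed n X) (Πd≥0 : ∀ t → T (inX n X d t) → 0ℚ Data.Rational.≤ Πd t) where
  open import Data.Nat as ℕ using (ℕ; zero; suc; _+_; _∸_)
  import Data.Nat.Properties as ℕₚ
  open import Data.Nat.Combinatorics using (_C_; nCk≡nC[n∸k]; nC1≡n)
  open import Data.Bool using (Bool; true; false; _∧_; T)
  open import Data.Bool.Properties using (T-∧; T-≡; ∧-comm; ∧-assoc; ∧-identityʳ)
  open import Data.Product using (proj₁; proj₂)
  open import Data.Unit using (tt)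
  open import Data.Fin.Subset using (Subset; ∣_∣; _─_; _∪_; _∩_)
  open import Data.Rational using (ℚ; 0ℚ; 1ℚ; _*_; _≤_; _≟_)
  open import Data.Rational.Properties using (*-identityˡ; *-identityʳ; *-assoc; *-zeroˡ; *-zeroʳ; ≤-refl; ≤-antisym)
  open import Relation.Binary.PropositionalEquality
  open import Relation.Nullary using (Dec; yes; no)
  open import Function.Bundles using (Equivalence)
  open import Data.Empty using (⊥-elim)
  open import Data.Rational.Solver
  open +-*-Solver
  open ℚ-Arithmetic
  open Sums
  open SubsetTests
  open Binomial using ([1+j]*dC[k+j]*[d∸k]C[1+j]≡[d∸k]Cj*[1+k+j]*dC[1+k+j])
  open IntervalCount
    using (uniform-⊆ᵇ; inInterval; 𝟙-inInterval; shiftedC; shiftedC-+; shiftedC-+-+; Σsub-inInterval; Σsub-inInterval-𝟙)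
  open FiniteDifference using (ℕ→ℚ-C≢0; Δ; Δ-cong; Δ-*ˡ; Δ-*ʳ; Δ-Σsub-comm; Δ-shiftedC/C)
  open Walks n d X Πd

  weight : Subset n → ℚ
  weight t = 𝟙 (inX n X d t) * Πd t

  mass : Subset n → ℚ
  mass b = Σsub n (λ t → weight t * 𝟙 (b ⊆ᵇ t))

  inX⇒∣∣≡ : ∀ {i} t → T (inX n X i t) → ∣ t ∣ ≡ i
  inX⇒∣∣≡ t t∈X = =ℕ⇒≡ (proj₂ (Equivalence.to (T-∧ {X t}) t∈X))

  Π≡ : ∀ i b → Π i b ≡ 𝟙 (∣ b ∣ =ℕ i) * (mass b * 1/₀ ℕ→ℚ (d C i))
  Π≡ i b = begin
    Π i b
      ≡⟨ Σsub-cong n term ⟩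
    Σsub n (λ t → 𝟙 (∣ b ∣ =ℕ i) * (weight t * 𝟙 (b ⊆ᵇ t) * 1/₀ ℕ→ℚ (d C i)))
      ≡⟨ Σsub-*ˡ n (𝟙 (∣ b ∣ =ℕ i)) (λ t → weight t * 𝟙 (b ⊆ᵇ t) * 1/₀ ℕ→ℚ (d C i)) ⟩
    𝟙 (∣ b ∣ =ℕ i) * Σsub n (λ t → weight t * 𝟙 (b ⊆ᵇ t) * 1/₀ ℕ→ℚ (d C i))
      ≡⟨ cong (𝟙 (∣ b ∣ =ℕ i) *_) (Σsub-*ʳ n (1/₀ ℕ→ℚ (d C i)) (λ t → weight t * 𝟙 (b ⊆ᵇ t))) ⟩
    𝟙 (∣ b ∣ =ℕ i) * (mass b * 1/₀ ℕ→ℚ (d C i)) ∎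
    where
    open ≡-Reasoning
    term : ∀ t → 𝟙 (inX n X d t) * (Πd t * uniform n (λ c → (c ⊆ᵇ t) ∧ (∣ c ∣ =ℕ i)) b)
               ≡ 𝟙 (∣ b ∣ =ℕ i) * (weight t * 𝟙 (b ⊆ᵇ t) * 1/₀ ℕ→ℚ (d C i))
    term t = begin
      𝟙 (inX n X d t) * (Πd t * uniform n (λ c → (c ⊆ᵇ t) ∧ (∣ c ∣ =ℕ i)) b)
        ≡⟨ cong (λ e → 𝟙 (inX n X d t) * (Πd t * e)) (uniform-⊆ᵇ n t b i) ⟩
      𝟙 (inX n X d t) * (Πd t * (𝟙 ((b ⊆ᵇ t) ∧ (∣ b ∣ =ℕ i)) * 1/₀ ℕ→ℚ (∣ t ∣ C i)))
        ≡⟨ 𝟙-*-cong (inX n X d t) (λ t∈X → cong₂ (λ x y → Πd t * (x * 1/₀ ℕ→ℚ (y C i)))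
                                                (𝟙-∧ (b ⊆ᵇ t) (∣ b ∣ =ℕ i)) (inX⇒∣∣≡ t t∈X)) ⟩
      𝟙 (inX n X d t) * (Πd t * (𝟙 (b ⊆ᵇ t) * 𝟙 (∣ b ∣ =ℕ i) * 1/₀ ℕ→ℚ (d C i)))
        ≡⟨ solve 5 (λ w p a e c → w :* (p :* (a :* e :* c)) := e :* (w :* p :* a :* c)) refl
             (𝟙 (inX n X d t)) (Πd t) (𝟙 (b ⊆ᵇ t)) (𝟙 (∣ b ∣ =ℕ i)) (1/₀ ℕ→ℚ (d C i)) ⟩
      𝟙 (∣ b ∣ =ℕ i) * (weight t * 𝟙 (b ⊆ᵇ t) * 1/₀ ℕ→ℚ (d C i)) ∎

  mass≡0⇒Π≡0 : ∀ i b → mass b ≡ 0ℚ → Π i b ≡ 0ℚ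
  mass≡0⇒Π≡0 i b mass[b]≡0 = begin
    Π i b                                             ≡⟨ Π≡ i b ⟩
    𝟙 (∣ b ∣ =ℕ i) * (mass b * 1/₀ ℕ→ℚ (d C i))       ≡⟨ cong (λ g → 𝟙 (∣ b ∣ =ℕ i) * (g * 1/₀ ℕ→ℚ (d C i))) mass[b]≡0 ⟩
    𝟙 (∣ b ∣ =ℕ i) * (0ℚ * 1/₀ ℕ→ℚ (d C i))           ≡⟨ cong (𝟙 (∣ b ∣ =ℕ i) *_) (*-zeroˡ (1/₀ ℕ→ℚ (d C i))) ⟩
    𝟙 (∣ b ∣ =ℕ i) * 0ℚ                               ≡⟨ *-zeroʳ (𝟙 (∣ b ∣ =ℕ i)) ⟩
    0ℚ                                                ∎
    where open ≡-Reasoning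

  weight-nonneg : ∀ t → 0ℚ ≤ weight t
  weight-nonneg t with inX n X d t in t∈X
  ... | true  = subst (0ℚ ≤_) (sym (*-identityˡ (Πd t))) (Πd≥0 t (subst T (sym t∈X) tt))
  ... | false = subst (0ℚ ≤_) (sym (*-zeroˡ (Πd t))) ≤-refl

  mass-nonneg : ∀ b → 0ℚ ≤ mass b
  mass-nonneg b = subst (_≤ mass b) (Σsub-0 n {λ _ → 0ℚ} (λ _ → refl))
    (Σsub-mono-≤ n (λ t → *-nonneg (weight t) (𝟙 (b ⊆ᵇ t)) (weight-nonneg t) (𝟙-nonneg (b ⊆ᵇ t))))

  mass-antitone : ∀ a b → T (a ⊆ᵇ b) → mass b ≤ mass a
  mass-antitone a b a⊆b = Σsub-mono-≤ n term
    where
    term : ∀ t → weight t * 𝟙 (b ⊆ᵇ t) ≤ weight t * 𝟙 (a ⊆ᵇ t)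
    term t with b ⊆ᵇ t in b⊆t
    ... | true  = subst (λ e → weight t * 1ℚ ≤ weight t * 𝟙 e)
                    (sym (Equivalence.to T-≡ (⊆ᵇ-trans a b t a⊆b (subst T (sym b⊆t) tt)))) ≤-refl
    ... | false = subst (_≤ weight t * 𝟙 (a ⊆ᵇ t)) (sym (*-zeroʳ (weight t)))
                    (*-nonneg (weight t) (𝟙 (a ⊆ᵇ t)) (weight-nonneg t) (𝟙-nonneg (a ⊆ᵇ t)))

  mass-⊆ᵇ-≡0 : ∀ a b → T (a ⊆ᵇ b) → mass a ≡ 0ℚ → mass b ≡ 0ℚ
  mass-⊆ᵇ-≡0 a b a⊆b ma≡0 = ≤-antisym (subst (mass b ≤_) ma≡0 (mass-antitone a b a⊆b)) (mass-nonneg b)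

  mass-∉X : ∀ t → X t ≡ false → mass t ≡ 0ℚ
  mass-∉X t t∉X = Σsub-0 n term
    where
    term : ∀ T′ → weight T′ * 𝟙 (t ⊆ᵇ T′) ≡ 0ℚ
    term T′ with inX n X d T′ in T′∈X | t ⊆ᵇ T′ in t⊆T′
    ... | false | b     = trans (cong (_* 𝟙 b) (*-zeroˡ (Πd T′))) (*-zeroˡ (𝟙 b))
    ... | true  | false = *-zeroʳ (1ℚ * Πd T′)
    ... | true  | true  = ⊥-elim (subst T t∉X
          (X-closed t T′ (⊆ᵇ⇒⊆ {p = t} {T′} (subst T (sym t⊆T′) tt))
            (proj₁ (Equivalence.to (T-∧ {X T′}) (subst T (sym T′∈X) tt)))))

  𝟙X*mass : ∀ t → 𝟙 (X t) * mass t ≡ mass t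
  𝟙X*mass t with X t in t∈X
  ... | true  = *-identityˡ (mass t)
  ... | false = trans (*-zeroˡ (mass t)) (sym (mass-∉X t t∈X))

  mass*1/₀mass*⊆ᵇ : ∀ t′ t x y →
    (mass t′ * 1/₀ mass t′) * (𝟙 (t′ ⊆ᵇ t) * x * mass t * y) ≡ 𝟙 (t′ ⊆ᵇ t) * x * mass t * y
  mass*1/₀mass*⊆ᵇ t′ t x y = by-cases (mass t′ ≟ 0ℚ)
    where
    open ≡-Reasoning
    a g g′ core : ℚ
    a = 𝟙 (t′ ⊆ᵇ t)
    g = mass t
    g′ = mass t′
    core = a * x * g * y
    by-cases : Dec (g′ ≡ 0ℚ) → (g′ * 1/₀ g′) * core ≡ core
    by-cases (no g′≢0)  = trans (cong (_* core) (*-1/₀-inverseʳ g′ g′≢0)) (*-identityˡ core)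
    by-cases (yes g′≡0) = begin
      (g′ * 1/₀ g′) * core  ≡⟨ cong (λ z → (z * 1/₀ g′) * core) g′≡0 ⟩
      (0ℚ * 1/₀ g′) * core  ≡⟨ solve 2 (λ i c → (con 0ℚ :* i) :* c := con 0ℚ) refl (1/₀ g′) core ⟩
      0ℚ                    ≡⟨ core≡0 ⟨
      core                  ∎
      where
      core≡0 : core ≡ 0ℚ
      core≡0 = begin
        a * x * g * y    ≡⟨ solve 4 (λ a x g y → a :* x :* g :* y := a :* (x :* g :* y)) refl a x g y ⟩
        a * (x * g * y)  ≡⟨ 𝟙-*-cong (t′ ⊆ᵇ t) (λ t′⊆t → cong (λ z → x * z * y) (mass-⊆ᵇ-≡0 t′ t t′⊆t g′≡0)) ⟩
        a * (x * 0ℚ * y) ≡⟨ solve 3 (λ a x y → a :* (x :* con 0ℚ :* y) := con 0ℚ) refl a x y ⟩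
        0ℚ               ∎

  upFactor : ℕ → ℚ
  upFactor m = ℕ→ℚ (d C m) * 1/₀ (ℕ→ℚ (suc m) * ℕ→ℚ (d C suc m))

  -- the mass of t′ cancels against the denominator Π m t′ of the up-step
  mass*up : ∀ m t′ t → ∣ t′ ∣ ≡ m →
    mass t′ * up t′ t ≡ 𝟙 (t′ ⊆ᵇ t) * 𝟙 (∣ t ∣ =ℕ suc m) * mass t * upFactor m
  mass*up m t′ t ∣t′∣≡m = begin
    mass t′ * up t′ t                 ≡⟨ cong (λ i → mass t′ * up-at i) ∣t′∣≡m ⟩
    g′ * up-at m                      ≡⟨ cong (g′ *_) up-at-m ⟩
    g′ * ((a * (e * x)) * ((e * (g * 1/₀ c₁)) * (1/₀ q * (1/₀ g′ * c₀))))
      ≡⟨ solve 9 (λ g′ a e x g i₁ iq ig′ c₀ →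
                    g′ :* ((a :* (e :* x)) :* ((e :* (g :* i₁)) :* (iq :* (ig′ :* c₀))))
                    := (g′ :* ig′) :* (a :* (e :* e) :* (x :* g) :* (c₀ :* (iq :* i₁)))) refl
           g′ a e x g (1/₀ c₁) (1/₀ q) (1/₀ g′) c₀ ⟩
    (g′ * 1/₀ g′) * (a * (e * e) * (x * g) * (c₀ * (1/₀ q * 1/₀ c₁)))
      ≡⟨ cong₂ (λ ee xg → (g′ * 1/₀ g′) * (a * ee * xg * (c₀ * (1/₀ q * 1/₀ c₁))))
               (𝟙-idem (∣ t ∣ =ℕ suc m)) (𝟙X*mass t) ⟩
    (g′ * 1/₀ g′) * (a * e * g * (c₀ * (1/₀ q * 1/₀ c₁)))
      ≡⟨ cong (λ f → (g′ * 1/₀ g′) * (a * e * g * (c₀ * f))) (1/₀-* q c₁) ⟨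
    (g′ * 1/₀ g′) * core              ≡⟨ mass*1/₀mass*⊆ᵇ t′ t e (upFactor m) ⟩
    core                              ∎
    where
    open ≡-Reasoning
    up-at : ℕ → ℚ
    up-at i = 𝟙 ((t′ ⊆ᵇ t) ∧ ((∣ t ∣ =ℕ suc i) ∧ X t)) * (Π (suc i) t ÷₀ (ℕ→ℚ (suc i) * Π i t′))
    a e x g g′ q c₀ c₁ core : ℚ
    a = 𝟙 (t′ ⊆ᵇ t)
    e = 𝟙 (∣ t ∣ =ℕ suc m)
    x = 𝟙 (X t)
    g = mass t
    g′ = mass t′
    q = ℕ→ℚ (suc m)
    c₀ = ℕ→ℚ (d C m)
    c₁ = ℕ→ℚ (d C suc m)
    core = a * e * g * upFactor m
    Π[t′]≡ : Π m t′ ≡ g′ * 1/₀ c₀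
    Π[t′]≡ = trans (Π≡ m t′) (trans (cong (λ b → 𝟙 b * (g′ * 1/₀ c₀)) (trans (cong (_=ℕ m) ∣t′∣≡m) (=ℕ-refl m)))
                                    (*-identityˡ (g′ * 1/₀ c₀)))
    up-at-m : up-at m ≡ (a * (e * x)) * ((e * (g * 1/₀ c₁)) * (1/₀ q * (1/₀ g′ * c₀)))
    up-at-m = begin
      up-at m
        ≡⟨ cong₂ _*_ (trans (𝟙-∧ (t′ ⊆ᵇ t) _) (cong (a *_) (𝟙-∧ (∣ t ∣ =ℕ suc m) (X t))))
                     (÷₀≡*1/₀ (Π (suc m) t) (q * Π m t′)) ⟩
      (a * (e * x)) * (Π (suc m) t * 1/₀ (q * Π m t′))
        ≡⟨ cong (λ z → (a * (e * x)) * z) (cong₂ (λ x y → x * 1/₀ (q * y)) (Π≡ (suc m) t) Π[t′]≡) ⟩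
      (a * (e * x)) * ((e * (g * 1/₀ c₁)) * 1/₀ (q * (g′ * 1/₀ c₀)))
        ≡⟨ cong (λ z → (a * (e * x)) * ((e * (g * 1/₀ c₁)) * z))
             (trans (1/₀-* q (g′ * 1/₀ c₀))
               (cong (1/₀ q *_) (trans (1/₀-* g′ (1/₀ c₀)) (cong (1/₀ g′ *_) (1/₀-involutive c₀))))) ⟩
      (a * (e * x)) * ((e * (g * 1/₀ c₁)) * (1/₀ q * (1/₀ g′ * c₀))) ∎

  Σsub-𝟙⊆ᵇ*mass : ∀ U i → Σsub n (λ t → 𝟙 (U ⊆ᵇ t) * 𝟙 (∣ t ∣ =ℕ i) * mass t)
                         ≡ Σsub n (λ T′ → weight T′ * Σsub n (λ t → 𝟙 (inInterval U T′ i t)))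
  Σsub-𝟙⊆ᵇ*mass U i = begin
    Σsub n (λ t → 𝟙 (U ⊆ᵇ t) * 𝟙 (∣ t ∣ =ℕ i) * mass t)
      ≡⟨ Σsub-cong n (λ t → Σsub-*ˡ n (𝟙 (U ⊆ᵇ t) * 𝟙 (∣ t ∣ =ℕ i)) (λ T′ → weight T′ * 𝟙 (t ⊆ᵇ T′))) ⟨
    Σsub n (λ t → Σsub n (λ T′ → 𝟙 (U ⊆ᵇ t) * 𝟙 (∣ t ∣ =ℕ i) * (weight T′ * 𝟙 (t ⊆ᵇ T′))))
      ≡⟨ Σsub-cong n (λ t → Σsub-cong n (λ T′ → reorder t T′)) ⟩
    Σsub n (λ t → Σsub n (λ T′ → weight T′ * 𝟙 (inInterval U T′ i t)))
      ≡⟨ Σsub-comm n n (λ t T′ → weight T′ * 𝟙 (inInterval U T′ i t)) ⟩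
    Σsub n (λ T′ → Σsub n (λ t → weight T′ * 𝟙 (inInterval U T′ i t)))
      ≡⟨ Σsub-cong n (λ T′ → Σsub-*ˡ n (weight T′) (λ t → 𝟙 (inInterval U T′ i t))) ⟩
    Σsub n (λ T′ → weight T′ * Σsub n (λ t → 𝟙 (inInterval U T′ i t))) ∎
    where
    open ≡-Reasoning
    reorder : ∀ t T′ → 𝟙 (U ⊆ᵇ t) * 𝟙 (∣ t ∣ =ℕ i) * (weight T′ * 𝟙 (t ⊆ᵇ T′))
                      ≡ weight T′ * 𝟙 (inInterval U T′ i t)
    reorder t T′ = begin
      𝟙 (U ⊆ᵇ t) * 𝟙 (∣ t ∣ =ℕ i) * (weight T′ * 𝟙 (t ⊆ᵇ T′))
        ≡⟨ solve 4 (λ a e w b → a :* e :* (w :* b) := w :* (a :* b :* e)) refl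
             (𝟙 (U ⊆ᵇ t)) (𝟙 (∣ t ∣ =ℕ i)) (weight T′) (𝟙 (t ⊆ᵇ T′)) ⟩
      weight T′ * (𝟙 (U ⊆ᵇ t) * 𝟙 (t ⊆ᵇ T′) * 𝟙 (∣ t ∣ =ℕ i))
        ≡⟨ cong (weight T′ *_) (𝟙-inInterval U T′ i t) ⟨
      weight T′ * 𝟙 (inInterval U T′ i t) ∎

  module UpWalkLaw (k : ℕ) (s : Subset n) (∣s∣≡k : ∣ s ∣ ≡ k) (mass[s]≢0 : mass s ≢ 0ℚ) where

    normaliser : ℕ → ℚ
    normaliser j = 1/₀ ℕ→ℚ ((d ∸ k) C j) * 1/₀ mass s

    law : ℕ → Subset n → ℚ
    law j t = 𝟙 (s ⊆ᵇ t) * 𝟙 (∣ t ∣ =ℕ (k + j)) * mass t * normaliser j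

    p≡law-0 : ∀ t → p 0 s t ≡ law 0 t
    p≡law-0 t = begin
      𝟙 (s == t)                                   ≡⟨ cong 𝟙 (==≡⊆ᵇ∧∣∣=ℕ∣∣ s t) ⟩
      𝟙 ((s ⊆ᵇ t) ∧ (∣ t ∣ =ℕ ∣ s ∣))              ≡⟨ 𝟙-∧ (s ⊆ᵇ t) (∣ t ∣ =ℕ ∣ s ∣) ⟩
      𝟙 (s ⊆ᵇ t) * 𝟙 (∣ t ∣ =ℕ ∣ s ∣)              ≡⟨ cong (λ i → 𝟙 (s ⊆ᵇ t) * 𝟙 (∣ t ∣ =ℕ i)) ∣s∣≡k+0 ⟩
      𝟙 (s ⊆ᵇ t) * 𝟙 (∣ t ∣ =ℕ (k + 0))              ≡⟨ *-identityʳ (𝟙 (s ⊆ᵇ t) * 𝟙 (∣ t ∣ =ℕ (k + 0))) ⟨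
      𝟙 (s ⊆ᵇ t) * 𝟙 (∣ t ∣ =ℕ (k + 0)) * 1ℚ
        ≡⟨ 𝟙²-*-cong (s ⊆ᵇ t) (∣ t ∣ =ℕ (k + 0)) (λ s⊆t ∣t∣≡k+0 → sym (at-s (t≡s s⊆t (=ℕ⇒≡ ∣t∣≡k+0)))) ⟩
      𝟙 (s ⊆ᵇ t) * 𝟙 (∣ t ∣ =ℕ (k + 0)) * (mass t * normaliser 0)
        ≡⟨ *-assoc (𝟙 (s ⊆ᵇ t) * 𝟙 (∣ t ∣ =ℕ (k + 0))) (mass t) (normaliser 0) ⟨
      law 0 t                                      ∎
      where
      open ≡-Reasoning
      ∣s∣≡k+0 : ∣ s ∣ ≡ k + 0
      ∣s∣≡k+0 = trans ∣s∣≡k (sym (ℕₚ.+-identityʳ k))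
      t≡s : T (s ⊆ᵇ t) → ∣ t ∣ ≡ k + 0 → t ≡ s
      t≡s s⊆t ∣t∣≡k+0 = sym (⊆ᵇ∧∣∣≡⇒≡ s t s⊆t (trans ∣t∣≡k+0 (sym ∣s∣≡k+0)))
      at-s : t ≡ s → mass t * normaliser 0 ≡ 1ℚ
      at-s refl = begin
        mass s * (1/₀ 1ℚ * 1/₀ mass s) ≡⟨ cong (λ i → mass s * (i * 1/₀ mass s)) 1/₀-1 ⟩
        mass s * (1ℚ * 1/₀ mass s)     ≡⟨ cong (mass s *_) (*-identityˡ (1/₀ mass s)) ⟩
        mass s * 1/₀ mass s            ≡⟨ *-1/₀-inverseʳ (mass s) mass[s]≢0 ⟩
        1ℚ                             ∎

    law*up : ∀ j t′ t → law j t′ * up t′ t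
      ≡ 𝟙 (inInterval s t (k + j) t′) * (𝟙 (∣ t ∣ =ℕ suc (k + j)) * mass t * (normaliser j * upFactor (k + j)))
    law*up j t′ t = begin
      law j t′ * up t′ t
        ≡⟨ solve 5 (λ a b g c u → a :* b :* g :* c :* u := a :* b :* (c :* (g :* u))) refl
             (𝟙 (s ⊆ᵇ t′)) (𝟙 (∣ t′ ∣ =ℕ (k + j))) (mass t′) (normaliser j) (up t′ t) ⟩
      𝟙 (s ⊆ᵇ t′) * 𝟙 (∣ t′ ∣ =ℕ (k + j)) * (normaliser j * (mass t′ * up t′ t))
        ≡⟨ 𝟙²-*-cong (s ⊆ᵇ t′) (∣ t′ ∣ =ℕ (k + j))
             (λ _ ∣t′∣≡k+j → cong (normaliser j *_) (mass*up (k + j) t′ t (=ℕ⇒≡ ∣t′∣≡k+j))) ⟩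
      𝟙 (s ⊆ᵇ t′) * 𝟙 (∣ t′ ∣ =ℕ (k + j)) * (normaliser j * (𝟙 (t′ ⊆ᵇ t) * e * mass t * upFactor (k + j)))
        ≡⟨ solve 7 (λ a b c f e g u → a :* b :* (c :* (f :* e :* g :* u)) := a :* f :* b :* (e :* g :* (c :* u))) refl
             (𝟙 (s ⊆ᵇ t′)) (𝟙 (∣ t′ ∣ =ℕ (k + j))) (normaliser j) (𝟙 (t′ ⊆ᵇ t)) e (mass t) (upFactor (k + j)) ⟩
      𝟙 (s ⊆ᵇ t′) * 𝟙 (t′ ⊆ᵇ t) * 𝟙 (∣ t′ ∣ =ℕ (k + j)) * (e * mass t * (normaliser j * upFactor (k + j)))
        ≡⟨ cong (_* (e * mass t * (normaliser j * upFactor (k + j)))) (𝟙-inInterval s t (k + j) t′) ⟨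
      𝟙 (inInterval s t (k + j) t′) * (e * mass t * (normaliser j * upFactor (k + j))) ∎
      where
      open ≡-Reasoning
      e : ℚ
      e = 𝟙 (∣ t ∣ =ℕ suc (k + j))

    normaliser-suc : ∀ j → k + suc j ℕ.≤ d →
      ℕ→ℚ (suc j) * (normaliser j * upFactor (k + j)) ≡ normaliser (suc j)
    normaliser-suc j k+1+j≤d = begin
      sj * ((1/₀ cm * 1/₀ mass s) * (c₀ * 1/₀ (q * c₁)))
        ≡⟨ solve 5 (λ sj icm iG c₀ iqc₁ → sj :* ((icm :* iG) :* (c₀ :* iqc₁)) := (sj :* c₀) :* (icm :* iqc₁) :* iG) refl
             sj (1/₀ cm) (1/₀ mass s) c₀ (1/₀ (q * c₁)) ⟩
      (sj * c₀) * (1/₀ cm * 1/₀ (q * c₁)) * 1/₀ mass s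
        ≡⟨ cong (λ z → (sj * c₀) * z * 1/₀ mass s) (1/₀-* cm (q * c₁)) ⟨
      (sj * c₀) * 1/₀ (cm * (q * c₁)) * 1/₀ mass s
        ≡⟨ cong (_* 1/₀ mass s) (*-1/₀-cross (cm * (q * c₁)) (sj * c₀) 1ℚ cm′ x≢0 cm′≢0 cross) ⟩
      1ℚ * 1/₀ cm′ * 1/₀ mass s
        ≡⟨ cong (_* 1/₀ mass s) (*-identityˡ (1/₀ cm′)) ⟩
      normaliser (suc j) ∎
      where
      open ≡-Reasoning
      m = d ∸ k
      sj cm cm′ c₀ c₁ q : ℚ
      sj = ℕ→ℚ (suc j)
      cm = ℕ→ℚ (m C j)
      cm′ = ℕ→ℚ (m C suc j)
      c₀ = ℕ→ℚ (d C (k + j))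
      c₁ = ℕ→ℚ (d C suc (k + j))
      q = ℕ→ℚ (suc (k + j))
      1+j≤m : suc j ℕ.≤ m
      1+j≤m = ℕₚ.m+n≤o⇒m≤o∸n (suc j) (subst (ℕ._≤ d) (ℕₚ.+-comm k (suc j)) k+1+j≤d)
      1+k+j≤d : suc (k + j) ℕ.≤ d
      1+k+j≤d = subst (ℕ._≤ d) (ℕₚ.+-suc k j) k+1+j≤d
      cm′≢0 : cm′ ≢ 0ℚ
      cm′≢0 = ℕ→ℚ-C≢0 1+j≤m
      x≢0 : cm * (q * c₁) ≢ 0ℚ
      x≢0 = *-≢0 cm (q * c₁) (ℕ→ℚ-C≢0 (ℕₚ.<⇒≤ 1+j≤m)) (*-≢0 q c₁ (ℕ→ℚ-≢0 {suc (k + j)} (λ ())) (ℕ→ℚ-C≢0 1+k+j≤d))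
      cross : (sj * c₀) * cm′ ≡ (cm * (q * c₁)) * 1ℚ
      cross = begin
        (sj * c₀) * cm′
          ≡⟨ cong (_* cm′) (ℕ→ℚ-* (suc j) (d C (k + j))) ⟨
        ℕ→ℚ (suc j ℕ.* (d C (k + j))) * cm′
          ≡⟨ ℕ→ℚ-* (suc j ℕ.* (d C (k + j))) (m C suc j) ⟨
        ℕ→ℚ ((suc j ℕ.* (d C (k + j))) ℕ.* (m C suc j))
          ≡⟨ cong ℕ→ℚ ([1+j]*dC[k+j]*[d∸k]C[1+j]≡[d∸k]Cj*[1+k+j]*dC[1+k+j] d k j) ⟩
        ℕ→ℚ ((m C j) ℕ.* (suc (k + j) ℕ.* (d C suc (k + j))))
          ≡⟨ ℕ→ℚ-* (m C j) (suc (k + j) ℕ.* (d C suc (k + j))) ⟩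
        cm * ℕ→ℚ (suc (k + j) ℕ.* (d C suc (k + j)))
          ≡⟨ cong (cm *_) (ℕ→ℚ-* (suc (k + j)) (d C suc (k + j))) ⟩
        cm * (q * c₁)
          ≡⟨ *-identityʳ (cm * (q * c₁)) ⟨
        (cm * (q * c₁)) * 1ℚ ∎

    ∣t─s∣≡1+j : ∀ j t → T (s ⊆ᵇ t) → ∣ t ∣ ≡ suc (k + j) → ∣ t ─ s ∣ ≡ suc j
    ∣t─s∣≡1+j j t s⊆t ∣t∣≡1+k+j = ℕₚ.+-cancelʳ-≡ k ∣ t ─ s ∣ (suc j) (begin
      ∣ t ─ s ∣ + k      ≡⟨ cong (∣ t ─ s ∣ +_) ∣s∣≡k ⟨
      ∣ t ─ s ∣ + ∣ s ∣  ≡⟨ ∣q─p∣+∣p∣≡∣q∣ s t s⊆t ⟩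
      ∣ t ∣              ≡⟨ ∣t∣≡1+k+j ⟩
      suc (k + j)        ≡⟨ cong suc (ℕₚ.+-comm k j) ⟩
      suc j + k          ∎)
      where open ≡-Reasoning

    law-suc : ∀ j → k + suc j ℕ.≤ d → ∀ t → Σsub n (λ t′ → law j t′ * up t′ t) ≡ law (suc j) t
    law-suc j k+1+j≤d t = begin
      Σsub n (λ t′ → law j t′ * up t′ t)
        ≡⟨ Σsub-cong n (λ t′ → law*up j t′ t) ⟩
      Σsub n (λ t′ → 𝟙 (inInterval s t (k + j) t′) * Q)
        ≡⟨ Σsub-*ʳ n Q (λ t′ → 𝟙 (inInterval s t (k + j) t′)) ⟩
      Σsub n (λ t′ → 𝟙 (inInterval s t (k + j) t′)) * Q
        ≡⟨ cong (_* Q) (Σsub-inInterval-𝟙 n s t (k + j)) ⟩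
      𝟙 (s ⊆ᵇ t) * ℕ→ℚ (shiftedC ∣ s ∣ ∣ t ─ s ∣ (k + j)) * Q
        ≡⟨ solve 6 (λ a c e g nj u → a :* c :* (e :* g :* (nj :* u)) := a :* e :* (c :* (nj :* u) :* g)) refl
             (𝟙 (s ⊆ᵇ t)) (ℕ→ℚ (shiftedC ∣ s ∣ ∣ t ─ s ∣ (k + j))) e (mass t) (normaliser j) (upFactor (k + j)) ⟩
      𝟙 (s ⊆ᵇ t) * e * (ℕ→ℚ (shiftedC ∣ s ∣ ∣ t ─ s ∣ (k + j)) * (normaliser j * upFactor (k + j)) * mass t)
        ≡⟨ 𝟙²-*-cong (s ⊆ᵇ t) (∣ t ∣ =ℕ suc (k + j)) (λ s⊆t ∣t∣≡ → cong (_* mass t)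
             (trans (cong (λ c → ℕ→ℚ c * (normaliser j * upFactor (k + j))) (#between s⊆t (=ℕ⇒≡ ∣t∣≡)))
                    (normaliser-suc j k+1+j≤d))) ⟩
      𝟙 (s ⊆ᵇ t) * e * (normaliser (suc j) * mass t)
        ≡⟨ cong (λ i → 𝟙 (s ⊆ᵇ t) * 𝟙 (∣ t ∣ =ℕ i) * (normaliser (suc j) * mass t)) (ℕₚ.+-suc k j) ⟨
      𝟙 (s ⊆ᵇ t) * 𝟙 (∣ t ∣ =ℕ (k + suc j)) * (normaliser (suc j) * mass t)
        ≡⟨ solve 4 (λ a e c g → a :* e :* (c :* g) := a :* e :* g :* c) refl
             (𝟙 (s ⊆ᵇ t)) (𝟙 (∣ t ∣ =ℕ (k + suc j))) (normaliser (suc j)) (mass t) ⟩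
      law (suc j) t ∎
      where
      open ≡-Reasoning
      e Q : ℚ
      e = 𝟙 (∣ t ∣ =ℕ suc (k + j))
      Q = e * mass t * (normaliser j * upFactor (k + j))
      #between : T (s ⊆ᵇ t) → ∣ t ∣ ≡ suc (k + j) → shiftedC ∣ s ∣ ∣ t ─ s ∣ (k + j) ≡ suc j
      #between s⊆t ∣t∣≡1+k+j = begin
        shiftedC ∣ s ∣ ∣ t ─ s ∣ (k + j) ≡⟨ cong₂ (λ b a → shiftedC b a (k + j)) ∣s∣≡k (∣t─s∣≡1+j j t s⊆t ∣t∣≡1+k+j) ⟩
        shiftedC k (suc j) (k + j)       ≡⟨ shiftedC-+ k (suc j) j ⟩
        suc j C j                        ≡⟨ nCk≡nC[n∸k] (ℕₚ.n≤1+n j) ⟩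
        suc j C (suc j ∸ j)              ≡⟨ cong (suc j C_) (ℕₚ.m+n∸n≡m 1 j) ⟩
        suc j C 1                        ≡⟨ nC1≡n (suc j) ⟩
        suc j                            ∎

    p≡law : ∀ j → k + j ℕ.≤ d → ∀ t → p j s t ≡ law j t
    p≡law zero    _       = p≡law-0
    p≡law (suc j) k+1+j≤d t = trans
      (Σsub-cong n (λ t′ → cong (_* up t′ t) (p≡law j (ℕₚ.≤-trans (ℕₚ.+-monoʳ-≤ k (ℕₚ.n≤1+n j)) k+1+j≤d) t′)))
      (law-suc j k+1+j≤d t)

  module SwapVersusCanonical (k l u : ℕ) (s s′ : Subset n) (∣s∣≡k : ∣ s ∣ ≡ k) (∣s′∣≡l : ∣ s′ ∣ ≡ l)
                             (mass[s]≢0 : mass s ≢ 0ℚ) (l≤k : l ℕ.≤ k) (k+l≤d : k + l ℕ.≤ d) (u≤l : u ℕ.≤ l) where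
    open UpWalkLaw k s ∣s∣≡k mass[s]≢0

    U : Subset n
    U = s ∪ s′

    k+u≤d : k + u ℕ.≤ d
    k+u≤d = ℕₚ.≤-trans (ℕₚ.+-monoʳ-≤ k u≤l) k+l≤d

    ∣s′∣=ℕl : (∣ s′ ∣ =ℕ l) ≡ true
    ∣s′∣=ℕl = trans (cong (_=ℕ l) ∣s′∣≡l) (=ℕ-refl l)

    swapStep : Subset n → Subset n → Bool
    swapStep t c = (c ⊆ᵇ t) ∧ ((∣ c ∣ =ℕ l) ∧ (∣ c ∩ (t ─ s) ∣ =ℕ u))

    swapStep≡inInterval : ∀ t → ∣ t ─ s ∣ ≡ u → ∀ c → swapStep t c ≡ inInterval (t ─ s) t l c
    swapStep≡inInterval t ∣t─s∣≡u c = begin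
      (c ⊆ᵇ t) ∧ ((∣ c ∣ =ℕ l) ∧ (∣ c ∩ (t ─ s) ∣ =ℕ u))
        ≡⟨ cong (λ i → (c ⊆ᵇ t) ∧ ((∣ c ∣ =ℕ l) ∧ (∣ c ∩ (t ─ s) ∣ =ℕ i))) ∣t─s∣≡u ⟨
      (c ⊆ᵇ t) ∧ ((∣ c ∣ =ℕ l) ∧ (∣ c ∩ (t ─ s) ∣ =ℕ ∣ t ─ s ∣))
        ≡⟨ cong (λ b → (c ⊆ᵇ t) ∧ ((∣ c ∣ =ℕ l) ∧ b)) (∣p∩q∣=ℕ∣q∣ c (t ─ s)) ⟩
      (c ⊆ᵇ t) ∧ ((∣ c ∣ =ℕ l) ∧ ((t ─ s) ⊆ᵇ c))
        ≡⟨ cong ((c ⊆ᵇ t) ∧_) (∧-comm (∣ c ∣ =ℕ l) ((t ─ s) ⊆ᵇ c)) ⟩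
      (c ⊆ᵇ t) ∧ (((t ─ s) ⊆ᵇ c) ∧ (∣ c ∣ =ℕ l))
        ≡⟨ ∧-assoc (c ⊆ᵇ t) ((t ─ s) ⊆ᵇ c) (∣ c ∣ =ℕ l) ⟨
      ((c ⊆ᵇ t) ∧ ((t ─ s) ⊆ᵇ c)) ∧ (∣ c ∣ =ℕ l)
        ≡⟨ cong (_∧ (∣ c ∣ =ℕ l)) (∧-comm (c ⊆ᵇ t) ((t ─ s) ⊆ᵇ c)) ⟩
      inInterval (t ─ s) t l c ∎
      where open ≡-Reasoning

    ℕ→ℚ-count-swapStep : ∀ t → T (s ⊆ᵇ t) → ∣ t ─ s ∣ ≡ u → ℕ→ℚ (count n (swapStep t)) ≡ ℕ→ℚ (k C (l ∸ u))
    ℕ→ℚ-count-swapStep t s⊆t ∣t─s∣≡u = begin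
      ℕ→ℚ (count n (swapStep t))
        ≡⟨ ℕ→ℚ-count n (swapStep t) ⟩
      Σsub n (λ c → 𝟙 (swapStep t c))
        ≡⟨ Σsub-cong n (λ c → cong 𝟙 (swapStep≡inInterval t ∣t─s∣≡u c)) ⟩
      Σsub n (λ c → 𝟙 (inInterval (t ─ s) t l c))
        ≡⟨ Σsub-inInterval n (t ─ s) t (q─p⊆ᵇq s t) l ⟩
      ℕ→ℚ (shiftedC ∣ t ─ s ∣ ∣ t ─ (t ─ s) ∣ l)
        ≡⟨ cong ℕ→ℚ (cong₂ (λ b a → shiftedC b a l) ∣t─s∣≡u (trans (cong ∣_∣ (q─[q─p]≡p s t s⊆t)) ∣s∣≡k)) ⟩
      ℕ→ℚ (shiftedC u k l)
        ≡⟨ cong (λ i → ℕ→ℚ (shiftedC u k i)) (ℕₚ.m+[n∸m]≡n u≤l) ⟨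
      ℕ→ℚ (shiftedC u k (u + (l ∸ u)))
        ≡⟨ cong ℕ→ℚ (shiftedC-+ u k (l ∸ u)) ⟩
      ℕ→ℚ (k C (l ∸ u)) ∎
      where open ≡-Reasoning

    swapStep[s′]≡U== : ∀ t → T (s ⊆ᵇ t) → ∣ t ─ s ∣ ≡ u → swapStep t s′ ≡ (U == t)
    swapStep[s′]≡U== t s⊆t ∣t─s∣≡u = begin
      swapStep t s′                                             ≡⟨ swapStep≡inInterval t ∣t─s∣≡u s′ ⟩
      ((t ─ s) ⊆ᵇ s′ ∧ s′ ⊆ᵇ t) ∧ (∣ s′ ∣ =ℕ l)                 ≡⟨ cong (((t ─ s) ⊆ᵇ s′ ∧ s′ ⊆ᵇ t) ∧_) ∣s′∣=ℕl ⟩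
      ((t ─ s) ⊆ᵇ s′ ∧ s′ ⊆ᵇ t) ∧ true                          ≡⟨ ∧-identityʳ ((t ─ s) ⊆ᵇ s′ ∧ s′ ⊆ᵇ t) ⟩
      (t ─ s) ⊆ᵇ s′ ∧ s′ ⊆ᵇ t
        ≡⟨ cong (_∧ ((t ─ s) ⊆ᵇ s′ ∧ s′ ⊆ᵇ t)) (Equivalence.to T-≡ s⊆t) ⟨
      s ⊆ᵇ t ∧ ((t ─ s) ⊆ᵇ s′ ∧ s′ ⊆ᵇ t)                        ≡⟨ ∪-== s s′ t ⟩
      U == t                                                    ∎
      where open ≡-Reasoning

    𝟙⊆ᵇ*𝟙U== : ∀ t → 𝟙 (s ⊆ᵇ t) * 𝟙 (U == t) ≡ 𝟙 (U == t)
    𝟙⊆ᵇ*𝟙U== t = begin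
      𝟙 (s ⊆ᵇ t) * 𝟙 (U == t)               ≡⟨ cong (λ b → 𝟙 (s ⊆ᵇ t) * 𝟙 b) (∪-== s s′ t) ⟨
      𝟙 (s ⊆ᵇ t) * 𝟙 (s ⊆ᵇ t ∧ R)           ≡⟨ cong (𝟙 (s ⊆ᵇ t) *_) (𝟙-∧ (s ⊆ᵇ t) R) ⟩
      𝟙 (s ⊆ᵇ t) * (𝟙 (s ⊆ᵇ t) * 𝟙 R)       ≡⟨ *-assoc (𝟙 (s ⊆ᵇ t)) (𝟙 (s ⊆ᵇ t)) (𝟙 R) ⟨
      𝟙 (s ⊆ᵇ t) * 𝟙 (s ⊆ᵇ t) * 𝟙 R         ≡⟨ cong (_* 𝟙 R) (𝟙-idem (s ⊆ᵇ t)) ⟩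
      𝟙 (s ⊆ᵇ t) * 𝟙 R                      ≡⟨ 𝟙-∧ (s ⊆ᵇ t) R ⟨
      𝟙 (s ⊆ᵇ t ∧ R)                        ≡⟨ cong 𝟙 (∪-== s s′ t) ⟩
      𝟙 (U == t)                            ∎
      where
      open ≡-Reasoning
      R : Bool
      R = (t ─ s) ⊆ᵇ s′ ∧ s′ ⊆ᵇ t

    C*swap-term : ∀ t → ℕ→ℚ (k C (l ∸ u)) * (p u s t * uniform n (swapStep t) s′)
                        ≡ 𝟙 (U == t) * (𝟙 (∣ t ∣ =ℕ (k + u)) * mass t * normaliser u)
    C*swap-term t = begin
      c * (p u s t * uniform n (swapStep t) s′)
        ≡⟨ cong (λ z → c * (z * uniform n (swapStep t) s′)) (p≡law u k+u≤d t) ⟩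
      c * (law u t * uniform n (swapStep t) s′)
        ≡⟨ solve 6 (λ c a e g ν x → c :* (a :* e :* g :* ν :* x) := a :* e :* (c :* x :* (g :* ν))) refl
             c (𝟙 (s ⊆ᵇ t)) e (mass t) (normaliser u) (uniform n (swapStep t) s′) ⟩
      𝟙 (s ⊆ᵇ t) * e * (c * uniform n (swapStep t) s′ * (mass t * normaliser u))
        ≡⟨ 𝟙²-*-cong (s ⊆ᵇ t) (∣ t ∣ =ℕ (k + u)) (λ s⊆t ∣t∣=k+u → cong (_* (mass t * normaliser u))
             (c*uniform s⊆t (∣t─s∣≡ s⊆t (=ℕ⇒≡ ∣t∣=k+u)))) ⟩
      𝟙 (s ⊆ᵇ t) * e * (𝟙 (U == t) * (mass t * normaliser u))
        ≡⟨ solve 5 (λ a e b g ν → a :* e :* (b :* (g :* ν)) := (a :* b) :* (e :* g :* ν)) refl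
             (𝟙 (s ⊆ᵇ t)) e (𝟙 (U == t)) (mass t) (normaliser u) ⟩
      𝟙 (s ⊆ᵇ t) * 𝟙 (U == t) * (e * mass t * normaliser u)
        ≡⟨ cong (_* (e * mass t * normaliser u)) (𝟙⊆ᵇ*𝟙U== t) ⟩
      𝟙 (U == t) * (e * mass t * normaliser u) ∎
      where
      open ≡-Reasoning
      c e : ℚ
      c = ℕ→ℚ (k C (l ∸ u))
      e = 𝟙 (∣ t ∣ =ℕ (k + u))
      ∣t─s∣≡ : T (s ⊆ᵇ t) → ∣ t ∣ ≡ k + u → ∣ t ─ s ∣ ≡ u
      ∣t─s∣≡ s⊆t ∣t∣≡k+u = ℕₚ.+-cancelʳ-≡ k ∣ t ─ s ∣ u
        (trans (cong (∣ t ─ s ∣ +_) (sym ∣s∣≡k)) (trans (∣q─p∣+∣p∣≡∣q∣ s t s⊆t) (trans ∣t∣≡k+u (ℕₚ.+-comm k u))))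
      c*uniform : T (s ⊆ᵇ t) → ∣ t ─ s ∣ ≡ u → c * uniform n (swapStep t) s′ ≡ 𝟙 (U == t)
      c*uniform s⊆t ∣t─s∣≡u = begin
        c * uniform n (swapStep t) s′
          ≡⟨ cong (c *_) (÷₀≡*1/₀ (𝟙 (swapStep t s′)) (ℕ→ℚ (count n (swapStep t)))) ⟩
        c * (𝟙 (swapStep t s′) * 1/₀ ℕ→ℚ (count n (swapStep t)))
          ≡⟨ cong₂ (λ b z → c * (𝟙 b * 1/₀ z)) (swapStep[s′]≡U== t s⊆t ∣t─s∣≡u) (ℕ→ℚ-count-swapStep t s⊆t ∣t─s∣≡u) ⟩
        c * (𝟙 (U == t) * 1/₀ c)
          ≡⟨ solve 3 (λ c b i → c :* (b :* i) := b :* (c :* i)) refl c (𝟙 (U == t)) (1/₀ c) ⟩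
        𝟙 (U == t) * (c * 1/₀ c)
          ≡⟨ cong (𝟙 (U == t) *_) (*-1/₀-inverseʳ c (ℕ→ℚ-C≢0 (ℕₚ.≤-trans (ℕₚ.m∸n≤m l u) l≤k))) ⟩
        𝟙 (U == t) * 1ℚ
          ≡⟨ *-identityʳ (𝟙 (U == t)) ⟩
        𝟙 (U == t) ∎

    C*swap : ℕ→ℚ (k C (l ∸ u)) * S k l u s s′ ≡ 𝟙 (∣ U ∣ =ℕ (k + u)) * mass U * normaliser u
    C*swap = begin
      ℕ→ℚ (k C (l ∸ u)) * S k l u s s′
        ≡⟨ Σsub-*ˡ n (ℕ→ℚ (k C (l ∸ u))) (λ t → p u s t * uniform n (swapStep t) s′) ⟨
      Σsub n (λ t → ℕ→ℚ (k C (l ∸ u)) * (p u s t * uniform n (swapStep t) s′))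
        ≡⟨ Σsub-cong n C*swap-term ⟩
      Σsub n (λ t → 𝟙 (U == t) * (𝟙 (∣ t ∣ =ℕ (k + u)) * mass t * normaliser u))
        ≡⟨ Σsub-δ n U (λ t → 𝟙 (∣ t ∣ =ℕ (k + u)) * mass t * normaliser u) ⟩
      𝟙 (∣ U ∣ =ℕ (k + u)) * mass U * normaliser u ∎
      where open ≡-Reasoning

    C*canonical-term : ∀ j → j ℕ.≤ u → ∀ t →
      ℕ→ℚ ((k + j) C l) * (p j s t * uniform n (λ c → (c ⊆ᵇ t) ∧ (∣ c ∣ =ℕ l)) s′)
        ≡ 𝟙 (U ⊆ᵇ t) * 𝟙 (∣ t ∣ =ℕ (k + j)) * mass t * normaliser j
    C*canonical-term j j≤u t = begin
      c * (p j s t * uniform n (λ c → (c ⊆ᵇ t) ∧ (∣ c ∣ =ℕ l)) s′)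
        ≡⟨ cong₂ (λ x y → c * (x * y)) (p≡law j k+j≤d t) (uniform-⊆ᵇ n t s′ l) ⟩
      c * (law j t * (𝟙 ((s′ ⊆ᵇ t) ∧ (∣ s′ ∣ =ℕ l)) * 1/₀ ℕ→ℚ (∣ t ∣ C l)))
        ≡⟨ cong (λ b → c * (law j t * (𝟙 b * 1/₀ ℕ→ℚ (∣ t ∣ C l))))
             (trans (cong ((s′ ⊆ᵇ t) ∧_) ∣s′∣=ℕl) (∧-identityʳ (s′ ⊆ᵇ t))) ⟩
      c * (law j t * (𝟙 (s′ ⊆ᵇ t) * 1/₀ ℕ→ℚ (∣ t ∣ C l)))
        ≡⟨ solve 7 (λ c a e g ν b i → c :* (a :* e :* g :* ν :* (b :* i)) := a :* e :* (c :* i :* (b :* g :* ν))) refl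
             c (𝟙 (s ⊆ᵇ t)) e (mass t) (normaliser j) (𝟙 (s′ ⊆ᵇ t)) (1/₀ ℕ→ℚ (∣ t ∣ C l)) ⟩
      𝟙 (s ⊆ᵇ t) * e * (c * 1/₀ ℕ→ℚ (∣ t ∣ C l) * rest)
        ≡⟨ 𝟙²-*-cong (s ⊆ᵇ t) (∣ t ∣ =ℕ (k + j)) (λ _ ∣t∣=k+j → cong (_* rest) (c*1/₀C (=ℕ⇒≡ ∣t∣=k+j))) ⟩
      𝟙 (s ⊆ᵇ t) * e * (1ℚ * rest)
        ≡⟨ solve 5 (λ a e b g ν → a :* e :* (con 1ℚ :* (b :* g :* ν)) := a :* b :* e :* g :* ν) refl
             (𝟙 (s ⊆ᵇ t)) e (𝟙 (s′ ⊆ᵇ t)) (mass t) (normaliser j) ⟩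
      𝟙 (s ⊆ᵇ t) * 𝟙 (s′ ⊆ᵇ t) * e * mass t * normaliser j
        ≡⟨ cong (λ z → z * e * mass t * normaliser j) (trans (sym (𝟙-∧ (s ⊆ᵇ t) (s′ ⊆ᵇ t))) (cong 𝟙 (∪-⊆ᵇ s s′ t))) ⟩
      𝟙 (U ⊆ᵇ t) * e * mass t * normaliser j ∎
      where
      open ≡-Reasoning
      k+j≤d : k + j ℕ.≤ d
      k+j≤d = ℕₚ.≤-trans (ℕₚ.+-monoʳ-≤ k j≤u) k+u≤d
      c e rest : ℚ
      c = ℕ→ℚ ((k + j) C l)
      e = 𝟙 (∣ t ∣ =ℕ (k + j))
      rest = 𝟙 (s′ ⊆ᵇ t) * mass t * normaliser j
      c*1/₀C : ∣ t ∣ ≡ k + j → c * 1/₀ ℕ→ℚ (∣ t ∣ C l) ≡ 1ℚ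
      c*1/₀C ∣t∣≡k+j = trans (cong (λ i → c * 1/₀ ℕ→ℚ (i C l)) ∣t∣≡k+j)
        (*-1/₀-inverseʳ c (ℕ→ℚ-C≢0 (ℕₚ.≤-trans l≤k (ℕₚ.m≤m+n k j))))

    #between : Subset n → ℕ → ℚ
    #between T′ j = Σsub n (λ t → 𝟙 (inInterval U T′ (k + j) t))

    C*canonical : ∀ j → j ℕ.≤ u →
      ℕ→ℚ ((k + j) C l) * N j k l s s′ ≡ Σsub n (λ T′ → weight T′ * (normaliser j * #between T′ j))
    C*canonical j j≤u = begin
      ℕ→ℚ ((k + j) C l) * N j k l s s′
        ≡⟨ Σsub-*ˡ n (ℕ→ℚ ((k + j) C l)) (λ t → p j s t * uniform n (λ c → (c ⊆ᵇ t) ∧ (∣ c ∣ =ℕ l)) s′) ⟨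
      Σsub n (λ t → ℕ→ℚ ((k + j) C l) * (p j s t * uniform n (λ c → (c ⊆ᵇ t) ∧ (∣ c ∣ =ℕ l)) s′))
        ≡⟨ Σsub-cong n (C*canonical-term j j≤u) ⟩
      Σsub n (λ t → 𝟙 (U ⊆ᵇ t) * 𝟙 (∣ t ∣ =ℕ (k + j)) * mass t * normaliser j)
        ≡⟨ Σsub-*ʳ n (normaliser j) (λ t → 𝟙 (U ⊆ᵇ t) * 𝟙 (∣ t ∣ =ℕ (k + j)) * mass t) ⟩
      Σsub n (λ t → 𝟙 (U ⊆ᵇ t) * 𝟙 (∣ t ∣ =ℕ (k + j)) * mass t) * normaliser j
        ≡⟨ cong (_* normaliser j) (Σsub-𝟙⊆ᵇ*mass U (k + j)) ⟩
      Σsub n (λ T′ → weight T′ * #between T′ j) * normaliser j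
        ≡⟨ Σsub-*ʳ n (normaliser j) (λ T′ → weight T′ * #between T′ j) ⟨
      Σsub n (λ T′ → weight T′ * #between T′ j * normaliser j)
        ≡⟨ Σsub-cong n (λ T′ → solve 3 (λ w b ν → w :* b :* ν := w :* (ν :* b)) refl
                                  (weight T′) (#between T′ j) (normaliser j)) ⟩
      Σsub n (λ T′ → weight T′ * (normaliser j * #between T′ j)) ∎
      where open ≡-Reasoning

    -- with ∣ U ∣ = k + δ, the faces between U and a top face T′ ⊇ U are counted by shiftedC δ (m ∸ δ)
    Δ-normaliser*shiftedC : ∀ T′ → T (inX n X d T′) → T (U ⊆ᵇ T′) →
      Δ u (λ j → normaliser j * ℕ→ℚ (shiftedC ∣ U ∣ ∣ T′ ─ U ∣ (k + j))) ≡ 𝟙 (∣ U ∣ =ℕ (k + u)) * normaliser u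
    Δ-normaliser*shiftedC T′ T′∈X U⊆T′ = begin
      Δ u (λ j → normaliser j * ℕ→ℚ (shiftedC ∣ U ∣ ∣ T′ ─ U ∣ (k + j)))
        ≡⟨ Δ-cong u (λ j _ → reorder j) ⟩
      Δ u (λ j → 1/₀ ℕ→ℚ (m C j) * ℕ→ℚ (shiftedC δ (m ∸ δ) j) * 1/₀ mass s)
        ≡⟨ Δ-*ʳ u (λ j → 1/₀ ℕ→ℚ (m C j) * ℕ→ℚ (shiftedC δ (m ∸ δ) j)) (1/₀ mass s) ⟩
      Δ u (λ j → 1/₀ ℕ→ℚ (m C j) * ℕ→ℚ (shiftedC δ (m ∸ δ) j)) * 1/₀ mass s
        ≡⟨ cong (_* 1/₀ mass s) (Δ-shiftedC/C m δ u u≤m) ⟩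
      𝟙 (u =ℕ δ) * 1/₀ ℕ→ℚ (m C u) * 1/₀ mass s
        ≡⟨ *-assoc (𝟙 (u =ℕ δ)) (1/₀ ℕ→ℚ (m C u)) (1/₀ mass s) ⟩
      𝟙 (u =ℕ δ) * normaliser u
        ≡⟨ cong (λ b → 𝟙 b * normaliser u) u=ℕδ≡∣U∣=ℕk+u ⟩
      𝟙 (∣ U ∣ =ℕ (k + u)) * normaliser u ∎
      where
      open ≡-Reasoning
      m δ : ℕ
      m = d ∸ k
      δ = ∣ U ∣ ∸ k
      u≤m : u ℕ.≤ m
      u≤m = ℕₚ.m+n≤o⇒m≤o∸n u (subst (ℕ._≤ d) (ℕₚ.+-comm k u) k+u≤d)
      k≤∣U∣ : k ℕ.≤ ∣ U ∣
      k≤∣U∣ = subst (ℕ._≤ ∣ U ∣) ∣s∣≡k (⊆ᵇ-∣∣-mono s U (p⊆ᵇp∪q s s′))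
      ∣U∣≡k+δ : ∣ U ∣ ≡ k + δ
      ∣U∣≡k+δ = sym (ℕₚ.m+[n∸m]≡n k≤∣U∣)
      ∣T′─U∣≡m∸δ : ∣ T′ ─ U ∣ ≡ m ∸ δ
      ∣T′─U∣≡m∸δ = begin
        ∣ T′ ─ U ∣                    ≡⟨ ℕₚ.m+n∸n≡m ∣ T′ ─ U ∣ ∣ U ∣ ⟨
        ∣ T′ ─ U ∣ + ∣ U ∣ ∸ ∣ U ∣    ≡⟨ cong (_∸ ∣ U ∣) (trans (∣q─p∣+∣p∣≡∣q∣ U T′ U⊆T′) (inX⇒∣∣≡ T′ T′∈X)) ⟩
        d ∸ ∣ U ∣                     ≡⟨ cong (d ∸_) ∣U∣≡k+δ ⟩
        d ∸ (k + δ)                   ≡⟨ ℕₚ.∸-+-assoc d k δ ⟨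
        m ∸ δ                         ∎
      reorder : ∀ j → normaliser j * ℕ→ℚ (shiftedC ∣ U ∣ ∣ T′ ─ U ∣ (k + j))
                    ≡ 1/₀ ℕ→ℚ (m C j) * ℕ→ℚ (shiftedC δ (m ∸ δ) j) * 1/₀ mass s
      reorder j = begin
        normaliser j * ℕ→ℚ (shiftedC ∣ U ∣ ∣ T′ ─ U ∣ (k + j))
          ≡⟨ cong (λ c → normaliser j * ℕ→ℚ c)
               (trans (cong₂ (λ b a → shiftedC b a (k + j)) ∣U∣≡k+δ ∣T′─U∣≡m∸δ) (shiftedC-+-+ k δ (m ∸ δ) j)) ⟩
        normaliser j * ℕ→ℚ (shiftedC δ (m ∸ δ) j)
          ≡⟨ solve 3 (λ i g c → (i :* g) :* c := i :* c :* g) refl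
               (1/₀ ℕ→ℚ (m C j)) (1/₀ mass s) (ℕ→ℚ (shiftedC δ (m ∸ δ) j)) ⟩
        1/₀ ℕ→ℚ (m C j) * ℕ→ℚ (shiftedC δ (m ∸ δ) j) * 1/₀ mass s ∎
      u=ℕδ≡∣U∣=ℕk+u : (u =ℕ δ) ≡ (∣ U ∣ =ℕ (k + u))
      u=ℕδ≡∣U∣=ℕk+u = trans (=ℕ-sym u δ) (trans (sym (+-=ℕ-cancelˡ k δ u)) (cong (_=ℕ (k + u)) (sym ∣U∣≡k+δ)))

    weight*Δ : ∀ T′ → weight T′ * Δ u (λ j → normaliser j * #between T′ j)
                      ≡ weight T′ * 𝟙 (U ⊆ᵇ T′) * (𝟙 (∣ U ∣ =ℕ (k + u)) * normaliser u)
    weight*Δ T′ = begin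
      weight T′ * Δ u (λ j → normaliser j * #between T′ j)
        ≡⟨ cong (weight T′ *_) (Δ-cong u (λ j _ → trans (cong (normaliser j *_) (Σsub-inInterval-𝟙 n U T′ (k + j)))
             (solve 3 (λ ν a c → ν :* (a :* c) := a :* (ν :* c)) refl (normaliser j) a (count# j)))) ⟩
      weight T′ * Δ u (λ j → a * (normaliser j * count# j))
        ≡⟨ cong (weight T′ *_) (Δ-*ˡ u a (λ j → normaliser j * count# j)) ⟩
      weight T′ * (a * Δ u (λ j → normaliser j * count# j))
        ≡⟨ solve 4 (λ x π a δ → x :* π :* (a :* δ) := x :* a :* (π :* δ)) refl
             (𝟙 (inX n X d T′)) (Πd T′) a (Δ u (λ j → normaliser j * count# j)) ⟩
      𝟙 (inX n X d T′) * a * (Πd T′ * Δ u (λ j → normaliser j * count# j))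
        ≡⟨ 𝟙²-*-cong (inX n X d T′) (U ⊆ᵇ T′) (λ T′∈X U⊆T′ → cong (Πd T′ *_) (Δ-normaliser*shiftedC T′ T′∈X U⊆T′)) ⟩
      𝟙 (inX n X d T′) * a * (Πd T′ * (𝟙 (∣ U ∣ =ℕ (k + u)) * normaliser u))
        ≡⟨ solve 4 (λ x a π r → x :* a :* (π :* r) := x :* π :* a :* r) refl
             (𝟙 (inX n X d T′)) a (Πd T′) (𝟙 (∣ U ∣ =ℕ (k + u)) * normaliser u) ⟩
      weight T′ * a * (𝟙 (∣ U ∣ =ℕ (k + u)) * normaliser u) ∎
      where
      open ≡-Reasoning
      a : ℚ
      a = 𝟙 (U ⊆ᵇ T′)
      count# : ℕ → ℚ
      count# j = ℕ→ℚ (shiftedC ∣ U ∣ ∣ T′ ─ U ∣ (k + j))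

    swap≡canonical : ℕ→ℚ (k C (l ∸ u)) * S k l u s s′
      ≡ Σupto u (λ j → sgn (u ∸ j) * ℕ→ℚ ((k + j) C l) * ℕ→ℚ (u C j) * N j k l s s′)
    swap≡canonical = sym (begin
      Σupto u (λ j → sgn (u ∸ j) * ℕ→ℚ ((k + j) C l) * ℕ→ℚ (u C j) * N j k l s s′)
        ≡⟨ Σupto-cong u (λ j _ → solve 4 (λ σ a b x → σ :* a :* b :* x := σ :* b :* (a :* x)) refl
                                   (sgn (u ∸ j)) (ℕ→ℚ ((k + j) C l)) (ℕ→ℚ (u C j)) (N j k l s s′)) ⟩
      Δ u (λ j → ℕ→ℚ ((k + j) C l) * N j k l s s′)
        ≡⟨ Δ-cong u C*canonical ⟩
      Δ u (λ j → Σsub n (λ T′ → weight T′ * (normaliser j * #between T′ j)))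
        ≡⟨ Δ-Σsub-comm u n (λ j T′ → weight T′ * (normaliser j * #between T′ j)) ⟩
      Σsub n (λ T′ → Δ u (λ j → weight T′ * (normaliser j * #between T′ j)))
        ≡⟨ Σsub-cong n (λ T′ → trans (Δ-*ˡ u (weight T′) (λ j → normaliser j * #between T′ j)) (weight*Δ T′)) ⟩
      Σsub n (λ T′ → weight T′ * 𝟙 (U ⊆ᵇ T′) * (𝟙 (∣ U ∣ =ℕ (k + u)) * normaliser u))
        ≡⟨ Σsub-*ʳ n (𝟙 (∣ U ∣ =ℕ (k + u)) * normaliser u) (λ T′ → weight T′ * 𝟙 (U ⊆ᵇ T′)) ⟩
      mass U * (𝟙 (∣ U ∣ =ℕ (k + u)) * normaliser u)
        ≡⟨ solve 3 (λ g e ν → g :* (e :* ν) := e :* g :* ν) refl (mass U) (𝟙 (∣ U ∣ =ℕ (k + u))) (normaliser u) ⟩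
      𝟙 (∣ U ∣ =ℕ (k + u)) * mass U * normaliser u
        ≡⟨ C*swap ⟨
      ℕ→ℚ (k C (l ∸ u)) * S k l u s s′ ∎)
      where open ≡-Reasoning

open import Data.Nat using (_+_; _∸_; _≤_)
open import Data.Nat.Combinatorics using (_C_)
open import Data.Rational using (_<_; _*_)
open import Data.Rational.Properties using (<-irrefl)
open import Data.Product using (_,_)
open import Relation.Binary.PropositionalEquality using (_≡_; _≢_; sym)

corollary4p13 : (n d k l : ℕ) (X : Subset n → Bool) (Πd : Subset n → ℚ) →
    DownwardClosed n X → Pure n d X → IsProbOnTop n d X Πd →
    l ≤ k → k + l ≤ d →
    (u : ℕ) → u ≤ l →
    (s s' : Subset n) → T (inX n X k s) → T (inX n X l s') →
    0ℚ < Walks.Π n d X Πd k s →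
    ℕ→ℚ (k C (l ∸ u)) * Walks.S n d X Πd k l u s s'
      ≡ Σupto u (λ j → sgn (u ∸ j) * ℕ→ℚ ((k + j) C l) * ℕ→ℚ (u C j)
                        * Walks.N n d X Πd j k l s s')
corollary4p13 n d k l X Πd X-closed _ (Πd≥0 , _) l≤k k+l≤d u u≤l s s′ s∈X s′∈X 0<Π[s] =
  SwapVersusCanonical.swap≡canonical k l u s s′ (inX⇒∣∣≡ s s∈X) (inX⇒∣∣≡ s′ s′∈X) mass[s]≢0 l≤k k+l≤d u≤l
  where
  open FaceMass n d X Πd X-closed Πd≥0
  mass[s]≢0 : mass s ≢ 0ℚ
  mass[s]≢0 mass[s]≡0 = <-irrefl (sym (mass≡0⇒Π≡0 k s mass[s]≡0)) 0<Π[s]
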